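{- Let $a,b$ be complex numbers and define $g(n,1,a,b)$ by $\sum_{n\ge0}g(n,1,a,b)z^n=\frac{1}{\sqrt{(1-az)^2-4bz}}$. Let $dd_k^{(1)}(n,a,b)=\det\big(g(i+j+k,1,a,b)\big)_{i,j=0}^{n-1}$. Then for $n>0$ $$dd_0^{(1)}(n,a,b)=2^{n-1}b^{\binom n2}(a+b)^{\binom n2},\qquad dd_1^{(1)}(n,a,b)=2^{n-1}b^{\binom n2}(a+b)^{\binom n2}\big((a+b)^n+b^n\big),$$ $$dd_2^{(1)}(n,a,b)=dd_0^{(1)}(n,a,b)\Big(2b^n(a+b)^n+\sum_{j=1}^n\big((a+b)^j+b^j\big)^2b^{n-j}(a+b)^{n-j}\Big)=dd_0^{(1)}(n,a,b)\Big(\frac{(a+b)^{2n+1}-b^{2n+1}}{a}+(2n+1)b^n(a+b)^n\Big).$$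
   Context: The power series $\frac{1}{\sqrt{(1-az)^2-4bz}}$ is the formal power series with constant term $1$. The quotient $\frac{(a+b)^{2n+1}-b^{2n+1}}{a}$ denotes the polynomial $\sum_{j=0}^{2n}(a+b)^jb^{2n-j}$. -}

module Defs where

open import Algebra.Bundles using (CommutativeRing)
open import Data.Nat as ℕ using (ℕ; zero; suc; _∸_)
open import Data.Product using (_×_)
open import Data.Fin using (Fin; zero; suc; toℕ; punchIn)

module Series {c ℓ} (R : CommutativeRing c ℓ) where
  open CommutativeRing R hiding (zero)

  pow : Carrier → ℕ → Carrier
  pow x zero    = 1#
  pow x (suc n) = x * pow x n

  fromℕ : ℕ → Carrier
  fromℕ zero    = 0#
  fromℕ (suc n) = 1# + fromℕ n

  sumRange : ℕ → ℕ → (ℕ → Carrier) → Carrier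
  sumRange m zero    f = 0#
  sumRange m (suc n) f = f m + sumRange (suc m) n f

  -- ∑ lo hi f = Σ_{j=lo}^{hi} f j  (inclusive; empty if hi < lo)
  ∑ : ℕ → ℕ → (ℕ → Carrier) → Carrier
  ∑ lo hi f = sumRange lo (suc hi ∸ lo) f

  FPS : Set c
  FPS = ℕ → Carrier

  oneS : FPS
  oneS zero    = 1#
  oneS (suc n) = 0#

  zS : FPS
  zS (suc zero) = 1#
  zS _          = 0#

  scalS : Carrier → FPS → FPS
  scalS r f n = r * f n

  _-S_ : FPS → FPS → FPS
  (f -S g) n = f n - g n

  _*S_ : FPS → FPS → FPS
  (f *S g) n = ∑ 0 n (λ k → f k * g (n ∸ k))

  Qser : Carrier → Carrier → FPS
  Qser a b = ((oneS -S scalS a zS) *S (oneS -S scalS a zS)) -S scalS (fromℕ 4 * b) zS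

  -- g is 1/sqrt(Q): constant term 1 and g^2 * Q = 1 (coefficientwise).
  IsInvSqrtOf : FPS → FPS → Set ℓ
  IsInvSqrtOf g Q = (g 0 ≈ 1#) × (∀ n → ((g *S g) *S Q) n ≈ oneS n)

  -- Determinant by Laplace expansion along the first row.
  altSum : ∀ {m} → Carrier → (Fin m → Carrier) → Carrier
  altSum {zero}  s f = 0#
  altSum {suc m} s f = s * f zero + altSum (- s) (λ j → f (suc j))

  det : ∀ n → (Fin n → Fin n → Carrier) → Carrier
  det zero    M = 1#
  det (suc n) M = altSum 1# (λ j → M zero j * det n (λ i k → M (suc i) (punchIn j k)))

  dd : FPS → ℕ → ℕ → Carrier
  dd g k n = det n (λ i j → g (toℕ i ℕ.+ toℕ j ℕ.+ k))

module Submission where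

-- With s = a + b, x = s + b and
-- k = b s, g(i) is the weight μ i 0 of Motzkin paths with level steps x and
-- down steps 2k (to height 0) or k (elsewhere): their generating series
-- satisfy continued-fraction recurrences forcing its square times
-- (1 - a z)² - 4 b z to be 1.  Cutting paths in the middle factors the
-- Hankel matrices as L D Lᵀ, L (T D) Lᵀ and L K Lᵀ, with L = (μ i m)
-- unitriangular, D diagonal, T the tridiagonal one-step matrix and
-- K = T D Tᵀ over one extra height.  The determinants follow by
-- multiplicativity, the triangular and tridiagonal expansions, and closed
-- forms of the resulting recurrences.

open import Defs
open import Algebra.Bundles using (CommutativeRing)
open import Data.Nat as ℕ using (ℕ; _<_; _∸_)
open import Data.Nat.Combinatorics using (_C_)
open import Data.Product using (_×_; _,_)

-- The standard ring solver needs a coefficient ring mapping into R; we use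
-- ℤ and construct its canonical homomorphism into an arbitrary
-- commutative ring.
module IntegerRingSolver {c ℓ} (R : CommutativeRing c ℓ) where

  open import Data.Nat using (zero; suc)
  import Data.Nat.Properties as ℕP
  open import Data.Integer as ℤ using (ℤ; +_; -[1+_]; _⊖_; _◃_; sign; ∣_∣)
  import Data.Integer.Properties as ℤP
  open import Data.Sign as Sign using (Sign)
  open import Data.Maybe using (Maybe; just; nothing)
  open import Relation.Nullary using (yes; no)
  import Relation.Binary.PropositionalEquality as P
  import Algebra.Solver.Ring.AlmostCommutativeRing as ACR
  open import Algebra.Properties.Ring using (-‿distribˡ-*; -‿involutive; -‿+-comm; -0#≈0#)
  open CommutativeRing R
  open import Relation.Binary.Reasoning.Setoid setoid

  -- n ↦ n·1, with 1 ↦ 1# on the nose so that solver constants are readable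
  nat : ℕ → Carrier
  nat zero = 0#
  nat (suc zero) = 1#
  nat (suc (suc n)) = 1# + nat (suc n)

  nat-suc : ∀ n → nat (suc n) ≈ 1# + nat n
  nat-suc zero = sym (+-identityʳ _)
  nat-suc (suc n) = refl

  nat-+ : ∀ m n → nat (m ℕ.+ n) ≈ nat m + nat n
  nat-+ zero n = sym (+-identityˡ _)
  nat-+ (suc m) n = begin
    nat (suc (m ℕ.+ n))    ≈⟨ nat-suc (m ℕ.+ n) ⟩
    1# + nat (m ℕ.+ n)     ≈⟨ +-congˡ (nat-+ m n) ⟩
    1# + (nat m + nat n)   ≈⟨ sym (+-assoc _ _ _) ⟩
    (1# + nat m) + nat n   ≈⟨ +-congʳ (sym (nat-suc m)) ⟩
    nat (suc m) + nat n    ∎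

  nat-* : ∀ m n → nat (m ℕ.* n) ≈ nat m * nat n
  nat-* zero n = sym (zeroˡ _)
  nat-* (suc m) n = begin
    nat (n ℕ.+ m ℕ.* n)          ≈⟨ nat-+ n (m ℕ.* n) ⟩
    nat n + nat (m ℕ.* n)        ≈⟨ +-cong (sym (*-identityˡ _)) (nat-* m n) ⟩
    1# * nat n + nat m * nat n   ≈⟨ sym (distribʳ _ _ _) ⟩
    (1# + nat m) * nat n         ≈⟨ *-congʳ (sym (nat-suc m)) ⟩
    nat (suc m) * nat n          ∎

  ι : ℤ → Carrier
  ι (+ n) = nat n
  ι -[1+ n ] = - nat (suc n)

  ι-⊖ : ∀ m n → ι (m ⊖ n) ≈ nat m - nat n
  ι-⊖ zero zero = sym (trans (+-congˡ (-0#≈0# ring)) (+-identityʳ _))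
  ι-⊖ (suc m) zero = sym (trans (+-congˡ (-0#≈0# ring)) (+-identityʳ _))
  ι-⊖ zero (suc n) = sym (+-identityˡ _)
  ι-⊖ (suc m) (suc n) = begin
    ι (suc m ⊖ suc n)               ≡⟨ P.cong ι (ℤP.[1+m]⊖[1+n]≡m⊖n m n) ⟩
    ι (m ⊖ n)                       ≈⟨ ι-⊖ m n ⟩
    nat m - nat n                   ≈⟨ cancel-1 ⟩
    (1# + nat m) - (1# + nat n)     ≈⟨ sym (+-cong (nat-suc m) (-‿cong (nat-suc n))) ⟩
    nat (suc m) - nat (suc n)       ∎
    where
    cancel-1 : nat m - nat n ≈ (1# + nat m) - (1# + nat n)
    cancel-1 = begin
      nat m + - nat n                      ≈⟨ sym (+-identityˡ _) ⟩
      0# + (nat m + - nat n)               ≈⟨ +-congʳ (sym (-‿inverseʳ 1#)) ⟩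
      (1# + - 1#) + (nat m + - nat n)      ≈⟨ +-assoc _ _ _ ⟩
      1# + (- 1# + (nat m + - nat n))      ≈⟨ +-congˡ (sym (+-assoc _ _ _)) ⟩
      1# + ((- 1# + nat m) + - nat n)      ≈⟨ +-congˡ (+-congʳ (+-comm _ _)) ⟩
      1# + ((nat m + - 1#) + - nat n)      ≈⟨ +-congˡ (+-assoc _ _ _) ⟩
      1# + (nat m + (- 1# + - nat n))      ≈⟨ sym (+-assoc _ _ _) ⟩
      (1# + nat m) + (- 1# + - nat n)      ≈⟨ +-congˡ (-‿+-comm ring 1# (nat n)) ⟩
      (1# + nat m) + - (1# + nat n)        ∎

  ι-+ : ∀ i j → ι (i ℤ.+ j) ≈ ι i + ι j
  ι-+ (+ m) (+ n) = nat-+ m n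
  ι-+ (+ m) -[1+ n ] = ι-⊖ m (suc n)
  ι-+ -[1+ m ] (+ n) = trans (ι-⊖ n (suc m)) (+-comm _ _)
  ι-+ -[1+ m ] -[1+ n ] = begin
    - nat (suc (suc (m ℕ.+ n)))     ≡⟨ P.cong (λ t → - nat (suc t)) (P.sym (ℕP.+-suc m n)) ⟩
    - nat (suc m ℕ.+ suc n)         ≈⟨ -‿cong (nat-+ (suc m) (suc n)) ⟩
    - (nat (suc m) + nat (suc n))   ≈⟨ sym (-‿+-comm ring _ _) ⟩
    - nat (suc m) + - nat (suc n)   ∎

  signValue : Sign → Carrier
  signValue Sign.+ = 1#
  signValue Sign.- = - 1#

  ι-◃ : ∀ s n → ι (s ◃ n) ≈ signValue s * nat n
  ι-◃ s zero = sym (zeroʳ _)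
  ι-◃ Sign.+ (suc n) = sym (*-identityˡ _)
  ι-◃ Sign.- (suc n) = trans (-‿cong (sym (*-identityˡ _))) (-‿distribˡ-* ring _ _)

  ι-signAbs : ∀ i → ι i ≈ signValue (sign i) * nat ∣ i ∣
  ι-signAbs (+ zero) = sym (zeroʳ _)
  ι-signAbs (+ suc n) = sym (*-identityˡ _)
  ι-signAbs -[1+ n ] = ι-◃ Sign.- (suc n)

  signValue-* : ∀ s t → signValue (s Sign.* t) ≈ signValue s * signValue t
  signValue-* Sign.+ t = sym (*-identityˡ _)
  signValue-* Sign.- Sign.+ = sym (*-identityʳ _)
  signValue-* Sign.- Sign.- = sym (begin
    - 1# * - 1#     ≈⟨ sym (-‿distribˡ-* ring _ _) ⟩
    - (1# * - 1#)   ≈⟨ -‿cong (*-identityˡ _) ⟩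
    - - 1#          ≈⟨ -‿involutive ring _ ⟩
    1#              ∎)

  ι-* : ∀ i j → ι (i ℤ.* j) ≈ ι i * ι j
  ι-* i j = begin
    ι (i ℤ.* j)
      ≈⟨ ι-◃ (sign i Sign.* sign j) (∣ i ∣ ℕ.* ∣ j ∣) ⟩
    signValue (sign i Sign.* sign j) * nat (∣ i ∣ ℕ.* ∣ j ∣)
      ≈⟨ *-cong (signValue-* (sign i) (sign j)) (nat-* ∣ i ∣ ∣ j ∣) ⟩
    (signValue (sign i) * signValue (sign j)) * (nat ∣ i ∣ * nat ∣ j ∣)
      ≈⟨ interchange ⟩
    (signValue (sign i) * nat ∣ i ∣) * (signValue (sign j) * nat ∣ j ∣)
      ≈⟨ sym (*-cong (ι-signAbs i) (ι-signAbs j)) ⟩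
    ι i * ι j ∎
    where
    interchange : ∀ {p q u v} → (p * q) * (u * v) ≈ (p * u) * (q * v)
    interchange {p} {q} {u} {v} = begin
      (p * q) * (u * v)   ≈⟨ *-assoc _ _ _ ⟩
      p * (q * (u * v))   ≈⟨ *-congˡ (sym (*-assoc _ _ _)) ⟩
      p * ((q * u) * v)   ≈⟨ *-congˡ (*-congʳ (*-comm _ _)) ⟩
      p * ((u * q) * v)   ≈⟨ *-congˡ (*-assoc _ _ _) ⟩
      p * (u * (q * v))   ≈⟨ sym (*-assoc _ _ _) ⟩
      (p * u) * (q * v)   ∎

  ι-neg : ∀ i → ι (ℤ.- i) ≈ - ι i
  ι-neg (+ zero) = sym (-0#≈0# ring)
  ι-neg (+ suc n) = refl
  ι-neg -[1+ n ] = sym (-‿involutive ring _)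

  ι-homomorphism : ℤ.+-*-rawRing ACR.-Raw-AlmostCommutative⟶ ACR.fromCommutativeRing R
  ι-homomorphism = record
    { ⟦_⟧ = ι ; +-homo = ι-+ ; *-homo = ι-* ; -‿homo = ι-neg
    ; 0-homo = refl ; 1-homo = refl }

  ι-equal? : ∀ i j → Maybe (ι i ≈ ι j)
  ι-equal? i j with i ℤ.≟ j
  ... | yes P.refl = just refl
  ... | no _ = nothing

  open import Algebra.Solver.Ring ℤ.+-*-rawRing (ACR.fromCommutativeRing R) ι-homomorphism ι-equal? public

  :0 :1 : ∀ {n} → Polynomial n
  :0 = con (+ 0)
  :1 = con (+ 1)

-- Identities valid in every commutative ring; they are applied to the ring
-- of power series, where the unknowns are series in z.
module RingIdentities {c ℓ} (R : CommutativeRing c ℓ) where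

  open CommutativeRing R
  open import Relation.Binary.Reasoning.Setoid setoid
  open IntegerRingSolver R using (solve; _:=_; _:+_; _:*_; _:-_; :0; :1)

  difference-zero⇒≈ : ∀ {X Y} → X - Y ≈ 0# → X ≈ Y
  difference-zero⇒≈ {X} {Y} h = begin
    X             ≈⟨ solve 2 (λ X Y → X := (X :- Y) :+ Y) refl X Y ⟩
    (X - Y) + Y   ≈⟨ +-congʳ h ⟩
    0# + Y        ≈⟨ +-identityˡ Y ⟩
    Y             ∎

  ≈⇒difference-zero : ∀ {X Y} → X ≈ Y → X - Y ≈ 0#
  ≈⇒difference-zero {X} {Y} h = trans (+-congʳ h) (-‿inverseʳ Y)

  casorati-shift : ∀ z x k P Q R T →
    Q ≈ z * (P + x * Q + k * R) → R ≈ z * (Q + x * R + k * T) →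
    z * z * (P * R - Q * Q) ≈ z * z * (k * (Q * T - R * R))
  casorati-shift z x k P Q R T eQ eR = difference-zero⇒≈ (begin
    z * z * (P * R - Q * Q) - z * z * (k * (Q * T - R * R))
      ≈⟨ solve 7 (λ z x k P Q R T →
           z :* z :* (P :* R :- Q :* Q) :- z :* z :* (k :* (Q :* T :- R :* R))
           := z :* R :* (z :* (P :+ x :* Q :+ k :* R) :- Q)
              :- z :* Q :* (z :* (Q :+ x :* R :+ k :* T) :- R)) refl z x k P Q R T ⟩
    z * R * (z * (P + x * Q + k * R) - Q) - z * Q * (z * (Q + x * R + k * T) - R)
      ≈⟨ +-cong (*-congˡ (≈⇒difference-zero (sym eQ))) (-‿cong (*-congˡ (≈⇒difference-zero (sym eR)))) ⟩
    z * R * 0# - z * Q * 0#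
      ≈⟨ solve 3 (λ z Q R → z :* R :* :0 :- z :* Q :* :0 := :0) refl z Q R ⟩
    0# ∎)

  quadratic-relation : ∀ z x k U₀ U₁ U₂ →
    U₀ ≈ 1# + z * (x * U₀ + (k + k) * U₁) → U₁ ≈ z * (U₀ + x * U₁ + k * U₂) →
    U₀ * U₂ ≈ U₁ * U₁ → U₁ + k * z * (U₁ * U₁) ≈ z * (U₀ * U₀)
  quadratic-relation z x k U₀ U₁ U₂ e₀ e₁ w = difference-zero⇒≈ (begin
    U₁ + k * z * (U₁ * U₁) - z * (U₀ * U₀)
      ≈⟨ solve 6 (λ z x k U₀ U₁ U₂ →
          U₁ :+ k :* z :* (U₁ :* U₁) :- z :* (U₀ :* U₀)
          := U₀ :* (U₁ :- z :* (U₀ :+ x :* U₁ :+ k :* U₂))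
             :- U₁ :* (U₀ :- (:1 :+ z :* (x :* U₀ :+ (k :+ k) :* U₁)))
             :+ k :* z :* (U₀ :* U₂ :- U₁ :* U₁)) refl z x k U₀ U₁ U₂ ⟩
    U₀ * (U₁ - z * (U₀ + x * U₁ + k * U₂)) - U₁ * (U₀ - (1# + z * (x * U₀ + (k + k) * U₁)))
      + k * z * (U₀ * U₂ - U₁ * U₁)
      ≈⟨ +-cong (+-cong (*-congˡ (≈⇒difference-zero e₁)) (-‿cong (*-congˡ (≈⇒difference-zero e₀))))
                (*-congˡ (≈⇒difference-zero w)) ⟩
    U₀ * 0# - U₁ * 0# + k * z * 0#
      ≈⟨ solve 4 (λ U₀ U₁ k z → U₀ :* :0 :- U₁ :* :0 :+ k :* z :* :0 := :0) refl U₀ U₁ k z ⟩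
    0# ∎)

  -- Eliminating U₁ between the first recurrence and the quadratic relation:
  -- U₀² ((1 - x z)² - 4 k z²) = 1.
  inverse-square-relation : ∀ z x k U₀ U₁ →
    U₀ ≈ 1# + z * (x * U₀ + (k + k) * U₁) → U₁ + k * z * (U₁ * U₁) ≈ z * (U₀ * U₀) →
    (U₀ * U₀) * ((1# - x * z) * (1# - x * z) - (k + k + k + k) * z * z) ≈ 1#
  inverse-square-relation z x k U₀ U₁ e₀ q = difference-zero⇒≈ (begin
    (U₀ * U₀) * ((1# - x * z) * (1# - x * z) - (k + k + k + k) * z * z) - 1#
      ≈⟨ solve 5 (λ z x k U₀ U₁ →
          (U₀ :* U₀) :* ((:1 :- x :* z) :* (:1 :- x :* z) :- (k :+ k :+ k :+ k) :* z :* z) :- :1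
          := (U₀ :- (:1 :+ z :* (x :* U₀ :+ (k :+ k) :* U₁))) :* (U₀ :* (:1 :- x :* z) :+ :1 :+ (k :+ k) :* z :* U₁)
             :+ (k :+ k :+ k :+ k) :* z :* (U₁ :+ k :* z :* (U₁ :* U₁) :- z :* (U₀ :* U₀))) refl z x k U₀ U₁ ⟩
    (U₀ - (1# + z * (x * U₀ + (k + k) * U₁))) * (U₀ * (1# - x * z) + 1# + (k + k) * z * U₁)
       + (k + k + k + k) * z * (U₁ + k * z * (U₁ * U₁) - z * (U₀ * U₀))
      ≈⟨ +-cong (*-congʳ (≈⇒difference-zero e₀)) (*-congˡ (≈⇒difference-zero q)) ⟩
    0# * (U₀ * (1# - x * z) + 1# + (k + k) * z * U₁) + (k + k + k + k) * z * 0#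
      ≈⟨ solve 5 (λ z x k U₀ U₁ → :0 :* (U₀ :* (:1 :- x :* z) :+ :1 :+ (k :+ k) :* z :* U₁)
                                   :+ (k :+ k :+ k :+ k) :* z :* :0 := :0) refl z x k U₀ U₁ ⟩
    0# ∎)

  inverse-unique : ∀ G V Q → G * Q ≈ 1# → V * Q ≈ 1# → G ≈ V
  inverse-unique G V Q gQ vQ = begin
    G             ≈⟨ sym (*-identityʳ G) ⟩
    G * 1#        ≈⟨ *-congˡ (sym vQ) ⟩
    G * (V * Q)   ≈⟨ solve 3 (λ G V Q → G :* (V :* Q) := (G :* Q) :* V) refl G V Q ⟩
    (G * Q) * V   ≈⟨ *-congʳ gQ ⟩
    1# * V        ≈⟨ *-identityˡ V ⟩
    V             ∎

  difference-of-squares : ∀ g u → g * g ≈ u * u → (g - u) * (g + u) ≈ 0#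
  difference-of-squares g u h = begin
    (g - u) * (g + u)   ≈⟨ solve 2 (λ g u → (g :- u) :* (g :+ u) := g :* g :- u :* u) refl g u ⟩
    g * g - u * u       ≈⟨ ≈⇒difference-zero h ⟩
    0#                  ∎

module FiniteSums {c ℓ} (R : CommutativeRing c ℓ) where

  open import Data.Nat using (zero; suc; z≤n; s≤s)
  import Data.Nat.Properties as ℕP
  open import Data.Fin as Fin using (Fin; toℕ)
  import Relation.Binary.PropositionalEquality as P
  open CommutativeRing R
  open import Relation.Binary.Reasoning.Setoid setoid
  open import Relation.Nullary using (yes; no)
  open import Data.Empty using (⊥-elim)
  open IntegerRingSolver R using (solve; _:=_; _:+_)
  open Series R using (sumRange)

  sum : ℕ → (ℕ → Carrier) → Carrier
  sum zero f = 0#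
  sum (suc n) f = f 0 + sum n (λ k → f (suc k))

  sum-cong< : ∀ n {f g} → (∀ k → k ℕ.< n → f k ≈ g k) → sum n f ≈ sum n g
  sum-cong< zero h = refl
  sum-cong< (suc n) h = +-cong (h 0 (s≤s z≤n)) (sum-cong< n (λ k k<n → h (suc k) (s≤s k<n)))

  sum-cong : ∀ n {f g} → (∀ k → f k ≈ g k) → sum n f ≈ sum n g
  sum-cong n h = sum-cong< n (λ k _ → h k)

  sum-+ : ∀ n f g → sum n (λ k → f k + g k) ≈ sum n f + sum n g
  sum-+ zero f g = sym (+-identityˡ _)
  sum-+ (suc n) f g = trans (+-congˡ (sum-+ n _ _))
    (solve 4 (λ a b x y → (a :+ b) :+ (x :+ y) := (a :+ x) :+ (b :+ y)) refl _ _ _ _)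

  sum-*ˡ : ∀ n a f → sum n (λ k → a * f k) ≈ a * sum n f
  sum-*ˡ zero a f = sym (zeroʳ _)
  sum-*ˡ (suc n) a f = trans (+-congˡ (sum-*ˡ n a _)) (sym (distribˡ _ _ _))

  sum-*ʳ : ∀ n a f → sum n (λ k → f k * a) ≈ sum n f * a
  sum-*ʳ n a f = trans (sum-cong n (λ k → *-comm _ _)) (trans (sum-*ˡ n a f) (*-comm _ _))

  sum-zero< : ∀ n {f} → (∀ k → k ℕ.< n → f k ≈ 0#) → sum n f ≈ 0#
  sum-zero< zero h = refl
  sum-zero< (suc n) h =
    trans (+-cong (h 0 (s≤s z≤n)) (sum-zero< n (λ k k<n → h (suc k) (s≤s k<n)))) (+-identityʳ _)

  sum-zero : ∀ n {f} → (∀ k → f k ≈ 0#) → sum n f ≈ 0#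
  sum-zero n h = sum-zero< n (λ k _ → h k)

  sum-last : ∀ n f → sum (suc n) f ≈ sum n f + f n
  sum-last zero f = trans (+-identityʳ _) (sym (+-identityˡ _))
  sum-last (suc n) f = trans (+-congˡ (sum-last n _)) (sym (+-assoc _ _ _))

  sum-swap : ∀ n m (f : ℕ → ℕ → Carrier) →
             sum n (λ i → sum m (λ j → f i j)) ≈ sum m (λ j → sum n (λ i → f i j))
  sum-swap zero m f = sym (sum-zero m (λ _ → refl))
  sum-swap (suc n) m f = begin
    sum m (f 0) + sum n (λ i → sum m (λ j → f (suc i) j))   ≈⟨ +-congˡ (sum-swap n m (λ i → f (suc i))) ⟩
    sum m (f 0) + sum m (λ j → sum n (λ i → f (suc i) j))   ≈⟨ sym (sum-+ m _ _) ⟩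
    sum m (λ j → f 0 j + sum n (λ i → f (suc i) j))         ∎

  sum-extend : ∀ n N f → n ℕ.≤ N → (∀ k → n ℕ.≤ k → f k ≈ 0#) → sum N f ≈ sum n f
  sum-extend n N f n≤N h with ℕP.m≤n⇒∃[o]m+o≡n n≤N
  ... | d , P.refl = padding n d f h
    where
    padding : ∀ n d f → (∀ k → n ℕ.≤ k → f k ≈ 0#) → sum (n ℕ.+ d) f ≈ sum n f
    padding zero d f h = sum-zero d (λ k → h k z≤n)
    padding (suc n) d f h = +-congˡ (padding n d _ (λ k n≤k → h (suc k) (s≤s n≤k)))

  sumRange≈sum : ∀ m L F → sumRange m L F ≈ sum L (λ t → F (m ℕ.+ t))
  sumRange≈sum m zero F = refl
  sumRange≈sum m (suc L) F = +-cong (reflexive (P.cong F (P.sym (ℕP.+-identityʳ m))))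
    (trans (sumRange≈sum (suc m) L F) (sum-cong L (λ t → reflexive (P.cong F (P.sym (ℕP.+-suc m t))))))

  δ : ℕ → ℕ → Carrier
  δ zero zero = 1#
  δ zero (suc _) = 0#
  δ (suc _) zero = 0#
  δ (suc i) (suc j) = δ i j

  δ-sym : ∀ i j → δ i j ≈ δ j i
  δ-sym zero zero = refl
  δ-sym zero (suc j) = refl
  δ-sym (suc i) zero = refl
  δ-sym (suc i) (suc j) = δ-sym i j

  δ-≢ : ∀ i j → i P.≢ j → δ i j ≈ 0#
  δ-≢ zero zero ne = ⊥-elim (ne P.refl)
  δ-≢ zero (suc j) ne = refl
  δ-≢ (suc i) zero ne = refl
  δ-≢ (suc i) (suc j) ne = δ-≢ i j (λ e → ne (P.cong suc e))

  δ-refl : ∀ i → δ i i ≈ 1#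
  δ-refl zero = refl
  δ-refl (suc i) = δ-refl i

  -- δ picks out the term q (if q is out of range, F q vanishes as well)
  sum-δ : ∀ N q F → (∀ r → N ℕ.≤ r → F r ≈ 0#) → sum N (λ r → δ r q * F r) ≈ F q
  sum-δ N q F hF with q ℕ.<? N
  ... | yes q<N = inside N q F q<N
    where
    inside : ∀ n q F → q ℕ.< n → sum n (λ r → δ r q * F r) ≈ F q
    inside (suc n) zero F _ = trans (+-cong (*-identityˡ _) (sum-zero n (λ k → zeroˡ _))) (+-identityʳ _)
    inside (suc n) (suc q) F (s≤s q<n) =
      trans (+-cong (zeroˡ _) (inside n q (λ r → F (suc r)) q<n)) (+-identityˡ _)
  ... | no q≮N = trans (outside N q F (ℕP.≮⇒≥ q≮N)) (sym (hF q (ℕP.≮⇒≥ q≮N)))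
    where
    outside : ∀ n q F → n ℕ.≤ q → sum n (λ r → δ r q * F r) ≈ 0#
    outside zero q F _ = refl
    outside (suc n) (suc q) F (s≤s n≤q) =
      trans (+-cong (zeroˡ _) (outside n q (λ r → F (suc r)) n≤q)) (+-identityˡ _)

  sumFin : ∀ {n} → (Fin n → Carrier) → Carrier
  sumFin {zero} f = 0#
  sumFin {suc n} f = f Fin.zero + sumFin (λ i → f (Fin.suc i))

  sumFin-cong : ∀ {n} {f g : Fin n → Carrier} → (∀ i → f i ≈ g i) → sumFin f ≈ sumFin g
  sumFin-cong {zero} h = refl
  sumFin-cong {suc n} h = +-cong (h Fin.zero) (sumFin-cong (λ i → h (Fin.suc i)))

  sumFin-toℕ : ∀ n F → sumFin {n} (λ i → F (toℕ i)) ≈ sum n F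
  sumFin-toℕ zero F = refl
  sumFin-toℕ (suc n) F = +-congˡ (sumFin-toℕ n (λ k → F (suc k)))

  prodFin : ∀ {n} → (Fin n → Carrier) → Carrier
  prodFin {zero} f = 1#
  prodFin {suc n} f = f Fin.zero * prodFin (λ i → f (Fin.suc i))

  prodFin-cong : ∀ {n} {f g : Fin n → Carrier} → (∀ i → f i ≈ g i) → prodFin f ≈ prodFin g
  prodFin-cong {zero} h = refl
  prodFin-cong {suc n} h = *-cong (h Fin.zero) (prodFin-cong (λ i → h (Fin.suc i)))

  prod : ℕ → (ℕ → Carrier) → Carrier
  prod zero f = 1#
  prod (suc n) f = f 0 * prod n (λ k → f (suc k))

  prodFin-toℕ : ∀ n F → prodFin {n} (λ i → F (toℕ i)) ≈ prod n F
  prodFin-toℕ zero F = refl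
  prodFin-toℕ (suc n) F = *-congˡ (prodFin-toℕ n (λ k → F (suc k)))

  prod-last : ∀ n f → prod (suc n) f ≈ prod n f * f n
  prod-last zero f = trans (*-identityʳ _) (sym (*-identityˡ _))
  prod-last (suc n) f = trans (*-congˡ (prod-last n _)) (sym (*-assoc _ _ _))

module PowerSeries {c ℓ} (R : CommutativeRing c ℓ) where

  open import Data.Nat using (zero; suc; s≤s)
  import Data.Nat.Properties as ℕP
  open import Relation.Nullary using (yes; no)
  open CommutativeRing R
  open import Relation.Binary.Reasoning.Setoid setoid
  open IntegerRingSolver R using (solve; _:=_; _:+_; _:*_)
  open FiniteSums R
  open Series R using (_*S_; oneS; zS)

  PS : Set c
  PS = ℕ → Carrier

  infix 4 _≋_
  _≋_ : PS → PS → Set ℓ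
  f ≋ g = ∀ n → f n ≈ g n

  infixl 6 _⊕_
  infixl 7 _⊛_
  _⊕_ : PS → PS → PS
  (f ⊕ g) n = f n + g n

  ⊝ : PS → PS
  ⊝ f n = - f n

  𝟘 : PS
  𝟘 _ = 0#

  𝟙 : PS
  𝟙 zero = 1#
  𝟙 (suc _) = 0#

  tail : PS → PS
  tail f k = f (suc k)

  _⊛_ : PS → PS → PS
  (f ⊛ g) zero = f 0 * g 0
  (f ⊛ g) (suc n) = f 0 * g (suc n) + (tail f ⊛ g) n

  scale : Carrier → PS → PS
  scale a f n = a * f n

  shift : PS → PS
  shift f zero = 0#
  shift f (suc n) = f n

  constant : Carrier → PS
  constant a zero = a
  constant a (suc _) = 0#

  ⊛-cong : ∀ {f f' g g'} → f ≋ f' → g ≋ g' → f ⊛ g ≋ f' ⊛ g'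
  ⊛-cong ff gg zero = *-cong (ff 0) (gg 0)
  ⊛-cong ff gg (suc n) = +-cong (*-cong (ff 0) (gg (suc n))) (⊛-cong (λ k → ff (suc k)) gg n)

  ⊛-zeroˡ : ∀ g → 𝟘 ⊛ g ≋ 𝟘
  ⊛-zeroˡ g zero = zeroˡ _
  ⊛-zeroˡ g (suc n) = trans (+-cong (zeroˡ _) (⊛-zeroˡ g n)) (+-identityʳ _)

  ⊛-identityˡ : ∀ g → 𝟙 ⊛ g ≋ g
  ⊛-identityˡ g zero = *-identityˡ _
  ⊛-identityˡ g (suc n) = trans (+-cong (*-identityˡ _) (⊛-zeroˡ g n)) (+-identityʳ _)

  ⊛-distribʳ : ∀ f f' g → (f ⊕ f') ⊛ g ≋ f ⊛ g ⊕ f' ⊛ g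
  ⊛-distribʳ f f' g zero = distribʳ _ _ _
  ⊛-distribʳ f f' g (suc n) = trans (+-cong (distribʳ _ _ _) (⊛-distribʳ (tail f) (tail f') g n))
    (solve 4 (λ a b x y → (a :+ b) :+ (x :+ y) := (a :+ x) :+ (b :+ y)) refl _ _ _ _)

  ⊛-distribˡ : ∀ f g g' → f ⊛ (g ⊕ g') ≋ f ⊛ g ⊕ f ⊛ g'
  ⊛-distribˡ f g g' zero = distribˡ _ _ _
  ⊛-distribˡ f g g' (suc n) = trans (+-cong (distribˡ _ _ _) (⊛-distribˡ (tail f) g g' n))
    (solve 4 (λ a b x y → (a :+ b) :+ (x :+ y) := (a :+ x) :+ (b :+ y)) refl _ _ _ _)

  ⊛-scaleˡ : ∀ a f g → scale a f ⊛ g ≋ scale a (f ⊛ g)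
  ⊛-scaleˡ a f g zero = *-assoc _ _ _
  ⊛-scaleˡ a f g (suc n) = trans (+-cong (*-assoc _ _ _) (⊛-scaleˡ a (tail f) g n)) (sym (distribˡ _ _ _))

  ⊛-tailʳ : ∀ f g n → (f ⊛ g) (suc n) ≈ g 0 * f (suc n) + (f ⊛ tail g) n
  ⊛-tailʳ f g zero = solve 4 (λ a b x y → a :* b :+ x :* y := y :* x :+ a :* b) refl _ _ _ _
  ⊛-tailʳ f g (suc n) = begin
    f 0 * g (suc (suc n)) + (tail f ⊛ g) (suc n)
      ≈⟨ +-congˡ (⊛-tailʳ (tail f) g n) ⟩
    f 0 * g (suc (suc n)) + (g 0 * f (suc (suc n)) + (tail f ⊛ tail g) n)
      ≈⟨ solve 3 (λ a b x → a :+ (b :+ x) := b :+ (a :+ x)) refl _ _ _ ⟩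
    g 0 * f (suc (suc n)) + (f 0 * g (suc (suc n)) + (tail f ⊛ tail g) n) ∎

  ⊛-comm : ∀ f g → f ⊛ g ≋ g ⊛ f
  ⊛-comm f g zero = *-comm _ _
  ⊛-comm f g (suc n) = begin
    f 0 * g (suc n) + (tail f ⊛ g) n   ≈⟨ +-congˡ (⊛-comm (tail f) g n) ⟩
    f 0 * g (suc n) + (g ⊛ tail f) n   ≈⟨ sym (⊛-tailʳ g f n) ⟩
    (g ⊛ f) (suc n)                    ∎

  ⊛-assoc : ∀ f g h → (f ⊛ g) ⊛ h ≋ f ⊛ (g ⊛ h)
  ⊛-assoc f g h zero = *-assoc _ _ _
  ⊛-assoc f g h (suc n) = begin
    (f 0 * g 0) * h (suc n) + (tail (f ⊛ g) ⊛ h) n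
      ≈⟨ +-congˡ (⊛-distribʳ (scale (f 0) (tail g)) (tail f ⊛ g) h n) ⟩
    (f 0 * g 0) * h (suc n) + ((scale (f 0) (tail g) ⊛ h) n + ((tail f ⊛ g) ⊛ h) n)
      ≈⟨ +-congˡ (+-cong (⊛-scaleˡ (f 0) (tail g) h n) (⊛-assoc (tail f) g h n)) ⟩
    (f 0 * g 0) * h (suc n) + (f 0 * (tail g ⊛ h) n + (tail f ⊛ (g ⊛ h)) n)
      ≈⟨ solve 5 (λ a b x y z → (a :* b) :* x :+ (a :* y :+ z) := a :* (b :* x :+ y) :+ z) refl _ _ _ _ _ ⟩
    f 0 * (g 0 * h (suc n) + (tail g ⊛ h) n) + (tail f ⊛ (g ⊛ h)) n ∎

  ⊛-identityʳ : ∀ g → g ⊛ 𝟙 ≋ g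
  ⊛-identityʳ g n = trans (⊛-comm g 𝟙 n) (⊛-identityˡ g n)

  seriesRing : CommutativeRing c ℓ
  seriesRing = record
    { Carrier = PS ; _≈_ = _≋_ ; _+_ = _⊕_ ; _*_ = _⊛_ ; -_ = ⊝ ; 0# = 𝟘 ; 1# = 𝟙
    ; isCommutativeRing = record
      { isRing = record
        { +-isAbelianGroup = record
          { isGroup = record
            { isMonoid = record
              { isSemigroup = record
                { isMagma = record
                  { isEquivalence = record
                    { refl = λ n → refl ; sym = λ p n → sym (p n) ; trans = λ p q n → trans (p n) (q n) }
                  ; ∙-cong = λ p q n → +-cong (p n) (q n) }
                ; assoc = λ f g h n → +-assoc _ _ _ }
              ; identity = (λ f n → +-identityˡ _) , (λ f n → +-identityʳ _) }
            ; inverse = (λ f n → -‿inverseˡ _) , (λ f n → -‿inverseʳ _)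
            ; ⁻¹-cong = λ p n → -‿cong (p n) }
          ; comm = λ f g n → +-comm _ _ }
        ; *-cong = ⊛-cong
        ; *-assoc = ⊛-assoc
        ; *-identity = ⊛-identityˡ , ⊛-identityʳ
        ; distrib = ⊛-distribˡ , (λ f g h → ⊛-distribʳ g h f) }
      ; *-comm = ⊛-comm } }

  constant-⊛ : ∀ a g → constant a ⊛ g ≋ scale a g
  constant-⊛ a g zero = refl
  constant-⊛ a g (suc n) = trans (+-congˡ (⊛-zeroˡ g n)) (+-identityʳ _)

  Z : PS
  Z = shift 𝟙

  Z-⊛ : ∀ g → Z ⊛ g ≋ shift g
  Z-⊛ g zero = zeroˡ _
  Z-⊛ g (suc n) = trans (+-cong (zeroˡ _) (⊛-identityˡ g n)) (+-identityˡ _)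

  Z-cancel : ∀ {f g} → Z ⊛ f ≋ Z ⊛ g → f ≋ g
  Z-cancel {f} {g} h n = trans (sym (Z-⊛ f (suc n))) (trans (h (suc n)) (Z-⊛ g (suc n)))

  constant-0 : constant 0# ≋ 𝟘
  constant-0 zero = refl
  constant-0 (suc n) = refl

  constant-1 : constant 1# ≋ 𝟙
  constant-1 zero = refl
  constant-1 (suc n) = refl

  constant-+ : ∀ a b → constant (a + b) ≋ constant a ⊕ constant b
  constant-+ a b zero = refl
  constant-+ a b (suc n) = sym (+-identityʳ _)

  constant-* : ∀ a b → constant (a * b) ≋ constant a ⊛ constant b
  constant-* a b zero = refl
  constant-* a b (suc n) = sym (trans (+-cong (zeroʳ _) (⊛-zeroˡ _ n)) (+-identityˡ _))

  sum-convolution : ∀ f g n → sum (suc n) (λ k → f k * g (n ℕ.∸ k)) ≈ (f ⊛ g) n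
  sum-convolution f g zero = +-identityʳ _
  sum-convolution f g (suc n) = +-congˡ (sum-convolution (tail f) g n)

  ⊛-order : ∀ f g p q → (∀ i → i ℕ.< p → f i ≈ 0#) → (∀ i → i ℕ.< q → g i ≈ 0#) →
            ∀ j → j ℕ.< p ℕ.+ q → (f ⊛ g) j ≈ 0#
  ⊛-order f g p q hf hg j j< = trans (sym (sum-convolution f g j)) (sum-zero< (suc j) term)
    where
    ∸-bound : ∀ j t p → p ℕ.≤ t → t ℕ.≤ j → j ℕ.< p ℕ.+ q → j ℕ.∸ t ℕ.< q
    ∸-bound j zero zero _ _ h = h
    ∸-bound (suc j) (suc t) zero _ t≤j h = ℕP.≤-<-trans (ℕP.m∸n≤m (suc j) (suc t)) h
    ∸-bound (suc j) (suc t) (suc p) (s≤s p≤t) (s≤s t≤j) (s≤s h) = ∸-bound j t p p≤t t≤j h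
    term : ∀ t → t ℕ.< suc j → f t * g (j ℕ.∸ t) ≈ 0#
    term t (s≤s t≤j) with t ℕ.<? p
    ... | yes t<p = trans (*-congʳ (hf t t<p)) (zeroˡ _)
    ... | no t≮p = trans (*-congˡ (hg _ (∸-bound j t p (ℕP.≮⇒≥ t≮p) t≤j j<))) (zeroʳ _)

  *S≋⊛ : ∀ f g → (f *S g) ≋ (f ⊛ g)
  *S≋⊛ f g n = trans (sumRange≈sum 0 (suc n) _) (sum-convolution f g n)

  oneS≋𝟙 : oneS ≋ 𝟙
  oneS≋𝟙 zero = refl
  oneS≋𝟙 (suc n) = refl

  zS≋Z : zS ≋ Z
  zS≋Z zero = refl
  zS≋Z (suc zero) = refl
  zS≋Z (suc (suc n)) = refl

module DiscriminantSeries {c ℓ} (R : CommutativeRing c ℓ) where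

  open PowerSeries R
  open IntegerRingSolver seriesRing using (solve; _:=_; _:+_; _:*_; _:-_; :0; :1)
  open CommutativeRing R using (refl)

  discriminant-forms : ∀ A B z →
    (𝟙 ⊕ ⊝ (A ⊛ z)) ⊛ (𝟙 ⊕ ⊝ (A ⊛ z)) ⊕ ⊝ ((𝟙 ⊕ (𝟙 ⊕ (𝟙 ⊕ (𝟙 ⊕ 𝟘)))) ⊛ B ⊛ z)
    ≋ (𝟙 ⊕ ⊝ ((A ⊕ B ⊕ B) ⊛ z)) ⊛ (𝟙 ⊕ ⊝ ((A ⊕ B ⊕ B) ⊛ z))
      ⊕ ⊝ ((B ⊛ (A ⊕ B) ⊕ B ⊛ (A ⊕ B) ⊕ B ⊛ (A ⊕ B) ⊕ B ⊛ (A ⊕ B)) ⊛ z ⊛ z)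
  discriminant-forms = solve 3 (λ A B z →
      (:1 :- A :* z) :* (:1 :- A :* z) :- (:1 :+ (:1 :+ (:1 :+ (:1 :+ :0)))) :* B :* z
      := (:1 :- (A :+ B :+ B) :* z) :* (:1 :- (A :+ B :+ B) :* z)
         :- (B :* (A :+ B) :+ B :* (A :+ B) :+ B :* (A :+ B) :+ B :* (A :+ B)) :* z :* z)
    (λ _ → refl)

-- With s = a + b, x = s + b, k = b s, the weight
-- μ i m of paths of length i from height 0 to height m uses up steps of
-- weight 1, level steps of weight x and a down step from height m of weight
-- down m (= 2k from height 1, k from higher levels).
module MotzkinPaths {c ℓ} (R : CommutativeRing c ℓ) (a b : CommutativeRing.Carrier R) where

  open import Data.Nat using (zero; suc; z≤n; s≤s)
  import Data.Nat.Properties as ℕP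
  import Relation.Binary.PropositionalEquality as P
  open CommutativeRing R
  open import Relation.Binary.Reasoning.Setoid setoid
  open import Algebra.Properties.Ring ring using (-0#≈0#)
  open IntegerRingSolver R using (solve; _:=_; _:+_; _:*_; :0; :1)
  open FiniteSums R
  open PowerSeries R
  open Series R using (_*S_; oneS; zS; scalS; _-S_; Qser; fromℕ)
  module Ser = CommutativeRing seriesRing
  module SerId = RingIdentities seriesRing

  s x k : Carrier
  s = a + b
  x = s + b
  k = b * s

  -- weight of a down step ending at height m - 1
  down : ℕ → Carrier
  down zero = 0#
  down (suc zero) = k + k
  down (suc (suc _)) = k

  -- μ i m: total weight of paths of length i from height 0 to height m,
  -- by decomposition according to the last step
  μ : ℕ → ℕ → Carrier
  μ zero zero = 1#
  μ zero (suc m) = 0#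
  μ (suc i) zero = x * μ i 0 + down 1 * μ i 1
  μ (suc i) (suc m) = μ i m + x * μ i (suc m) + down (suc (suc m)) * μ i (suc (suc m))

  μ-unreachable : ∀ i m → i ℕ.< m → μ i m ≈ 0#
  μ-unreachable zero (suc m) _ = refl
  μ-unreachable (suc i) (suc m) (s≤s i<m) = begin
    μ i m + x * μ i (suc m) + down (suc (suc m)) * μ i (suc (suc m))
      ≈⟨ +-cong (+-cong (μ-unreachable i m i<m) (*-congˡ (μ-unreachable i (suc m) (ℕP.m<n⇒m<1+n i<m))))
                (*-congˡ (μ-unreachable i (suc (suc m)) (ℕP.m<n⇒m<1+n (ℕP.m<n⇒m<1+n i<m)))) ⟩
    0# + x * 0# + down (suc (suc m)) * 0#
      ≈⟨ solve 2 (λ x l → :0 :+ x :* :0 :+ l :* :0 := :0) refl x (down (suc (suc m))) ⟩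
    0# ∎

  -- and in exactly m steps only by going straight up
  μ-diagonal : ∀ i → μ i i ≈ 1#
  μ-diagonal zero = refl
  μ-diagonal (suc i) = begin
    μ i i + x * μ i (suc i) + down (suc (suc i)) * μ i (suc (suc i))
      ≈⟨ +-cong (+-cong (μ-diagonal i) (*-congˡ (μ-unreachable i (suc i) (ℕP.n<1+n i))))
                (*-congˡ (μ-unreachable i (suc (suc i)) (ℕP.m<n⇒m<1+n (ℕP.n<1+n i)))) ⟩
    1# + x * 0# + k * 0#
      ≈⟨ solve 2 (λ x l → :1 :+ x :* :0 :+ l :* :0 := :1) refl x k ⟩
    1# ∎

  U : ℕ → PS
  U m i = μ i m

  U-order : ∀ m i → i ℕ.< m → U m i ≈ 0#
  U-order m i i<m = μ-unreachable i m i<m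

  U₀-recurrence : U 0 ≋ 𝟙 ⊕ Z ⊛ (constant x ⊛ U 0 ⊕ (constant k ⊕ constant k) ⊛ U 1)
  U₀-recurrence zero = sym (trans (+-congˡ (Z-⊛ (constant x ⊛ U 0 ⊕ (constant k ⊕ constant k) ⊛ U 1) 0)) (+-identityʳ _))
  U₀-recurrence (suc i) = sym (begin
    0# + (Z ⊛ (constant x ⊛ U 0 ⊕ (constant k ⊕ constant k) ⊛ U 1)) (suc i)
      ≈⟨ +-identityˡ _ ⟩
    (Z ⊛ (constant x ⊛ U 0 ⊕ (constant k ⊕ constant k) ⊛ U 1)) (suc i)
      ≈⟨ Z-⊛ _ (suc i) ⟩
    (constant x ⊛ U 0) i + ((constant k ⊕ constant k) ⊛ U 1) i
      ≈⟨ +-cong (constant-⊛ x (U 0) i)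
                (trans (⊛-cong (λ n → sym (constant-+ k k n)) (λ _ → refl) i) (constant-⊛ (k + k) (U 1) i)) ⟩
    x * μ i 0 + (k + k) * μ i 1 ∎)

  U-recurrence : ∀ m → U (suc m) ≋ Z ⊛ (U m ⊕ constant x ⊛ U (suc m) ⊕ constant k ⊛ U (suc (suc m)))
  U-recurrence m zero = sym (Z-⊛ (U m ⊕ constant x ⊛ U (suc m) ⊕ constant k ⊛ U (suc (suc m))) 0)
  U-recurrence m (suc i) = sym (trans (Z-⊛ _ (suc i)) (+-cong (+-congˡ (constant-⊛ x _ i)) (constant-⊛ k _ i)))

  W : ℕ → PS
  W m = U m ⊛ U (suc (suc m)) ⊕ ⊝ (U (suc m) ⊛ U (suc m))

  W-recurrence : ∀ m → W m ≋ constant k ⊛ W (suc m)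
  W-recurrence m = Z-cancel (Z-cancel (λ n → trans (sym (⊛-assoc Z Z _ n))
    (trans (SerId.casorati-shift Z (constant x) (constant k) (U m) (U (suc m)) (U (suc (suc m)))
              (U (suc (suc (suc m)))) (U-recurrence m) (U-recurrence (suc m)) n)
           (⊛-assoc Z Z _ n))))

  W-order : ∀ m j → j ℕ.< m ℕ.+ suc (suc m) → W m j ≈ 0#
  W-order m j j< = trans
    (+-cong (⊛-order (U m) (U (suc (suc m))) m (suc (suc m)) (U-order m) (U-order (suc (suc m))) j j<)
            (-‿cong (⊛-order (U (suc m)) (U (suc m)) (suc m) (suc m) (U-order (suc m)) (U-order (suc m)) j
                       (P.subst (j ℕ.<_) (ℕP.+-suc m (suc m)) j<))))
    (trans (+-congˡ -0#≈0#) (+-identityʳ _))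

  -- iterating W m = k W (m+1) pushes the order of W m beyond any bound
  W-vanishes : ∀ t m j → j ℕ.< (m ℕ.+ t) ℕ.+ suc (suc (m ℕ.+ t)) → W m j ≈ 0#
  W-vanishes zero m j j< = W-order m j (P.subst (λ u → j ℕ.< u ℕ.+ suc (suc u)) (ℕP.+-identityʳ m) j<)
  W-vanishes (suc t) m j j< = begin
    W m j                   ≈⟨ W-recurrence m j ⟩
    (constant k ⊛ W (suc m)) j ≈⟨ constant-⊛ k _ j ⟩
    k * W (suc m) j         ≈⟨ *-congˡ (W-vanishes t (suc m) j
                                 (P.subst (λ u → j ℕ.< u ℕ.+ suc (suc u)) (ℕP.+-suc m t) j<)) ⟩
    k * 0#                  ≈⟨ zeroʳ _ ⟩
    0#                      ∎

  U₀U₂≋U₁² : U 0 ⊛ U 2 ≋ U 1 ⊛ U 1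
  U₀U₂≋U₁² = SerId.difference-zero⇒≈ (λ j → W-vanishes j 0 j
    (ℕP.≤-trans (ℕP.m≤n+m (suc j) j) (ℕP.+-monoʳ-≤ j (ℕP.n≤1+n (suc j)))))

  Qxk : PS
  Qxk = (𝟙 ⊕ ⊝ (constant x ⊛ Z)) ⊛ (𝟙 ⊕ ⊝ (constant x ⊛ Z))
        ⊕ ⊝ ((constant k ⊕ constant k ⊕ constant k ⊕ constant k) ⊛ Z ⊛ Z)

  U₀²Qxk≋1 : (U 0 ⊛ U 0) ⊛ Qxk ≋ 𝟙
  U₀²Qxk≋1 = SerId.inverse-square-relation Z (constant x) (constant k) (U 0) (U 1) U₀-recurrence
    (SerId.quadratic-relation Z (constant x) (constant k) (U 0) (U 1) (U 2) U₀-recurrence (U-recurrence 0) U₀U₂≋U₁²)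

  Qser≋Qxk : Qser a b ≋ Qxk
  Qser≋Qxk = Ser.trans Qser≋discriminant (Ser.trans (discriminant-forms (constant a) (constant b) Z)
    (Ser.+-cong (Ser.*-cong (Ser.+-congˡ (Ser.-‿cong (Ser.*-congʳ (Ser.sym constant-x))))
                            (Ser.+-congˡ (Ser.-‿cong (Ser.*-congʳ (Ser.sym constant-x)))))
                (Ser.-‿cong (Ser.*-congʳ (Ser.*-congʳ (Ser.+-cong (Ser.+-cong (Ser.+-cong
                  (Ser.sym constant-k) (Ser.sym constant-k)) (Ser.sym constant-k)) (Ser.sym constant-k)))))))
    where
    open DiscriminantSeries R using (discriminant-forms)
    constant-four : constant (fromℕ 4 * b) ≋ (𝟙 ⊕ (𝟙 ⊕ (𝟙 ⊕ (𝟙 ⊕ 𝟘)))) ⊛ constant b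
    constant-four n = trans (constant-* _ b n) (⊛-cong four (λ _ → refl) n)
      where
      four : constant (fromℕ 4) ≋ 𝟙 ⊕ (𝟙 ⊕ (𝟙 ⊕ (𝟙 ⊕ 𝟘)))
      four m = trans (constant-+ _ _ m) (+-cong (constant-1 m) (trans (constant-+ _ _ m) (+-cong (constant-1 m)
        (trans (constant-+ _ _ m) (+-cong (constant-1 m) (trans (constant-+ _ _ m) (+-cong (constant-1 m)
        (constant-0 m))))))))
    constant-x : constant x ≋ constant a ⊕ constant b ⊕ constant b
    constant-x n = trans (constant-+ _ _ n) (+-congʳ (constant-+ a b n))
    constant-k : constant k ≋ constant b ⊛ (constant a ⊕ constant b)
    constant-k n = trans (constant-* b _ n) (⊛-cong (λ _ → refl) (constant-+ a b) n)
    linear : (oneS -S scalS a zS) ≋ 𝟙 ⊕ ⊝ (constant a ⊛ Z)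
    linear m = +-cong (oneS≋𝟙 m) (-‿cong (trans (*-congˡ (zS≋Z m)) (sym (constant-⊛ a Z m))))
    Qser≋discriminant : Qser a b ≋ (𝟙 ⊕ ⊝ (constant a ⊛ Z)) ⊛ (𝟙 ⊕ ⊝ (constant a ⊛ Z))
                                   ⊕ ⊝ ((𝟙 ⊕ (𝟙 ⊕ (𝟙 ⊕ (𝟙 ⊕ 𝟘)))) ⊛ constant b ⊛ Z)
    Qser≋discriminant n = +-cong (trans (*S≋⊛ _ _ n) (⊛-cong linear linear n))
      (-‿cong (trans (*-congˡ (zS≋Z n)) (trans (sym (constant-⊛ _ Z n)) (⊛-cong constant-four (λ _ → refl) n))))

  -- Since (1 - a z)² - 4 b z has the two inverse square roots ±U 0 and 2
  -- is regular, the series with constant term 1 is U 0: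
  -- (g - U 0)(g + U 0) = 0 and g + U 0 has constant term 2.
  g≈μ : (∀ y → y + y ≈ 0# → y ≈ 0#) → (g : ℕ → Carrier) → g 0 ≈ 1# →
        (∀ n → ((g *S g) *S Qser a b) n ≈ oneS n) → ∀ n → g n ≈ μ n 0
  g≈μ two g g0 hg n = RingIdentities.difference-zero⇒≈ R (d-vanishes n n ℕP.≤-refl)
    where
    gg≋U₀U₀ : g ⊛ g ≋ U 0 ⊛ U 0
    gg≋U₀U₀ = SerId.inverse-unique (g ⊛ g) (U 0 ⊛ U 0) Qxk
      (λ n → trans (sym (trans (*S≋⊛ _ _ n) (⊛-cong (*S≋⊛ g g) Qser≋Qxk n))) (trans (hg n) (oneS≋𝟙 n)))
      U₀²Qxk≋1
    d : ℕ → Carrier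
    d n = g n - μ n 0
    -- if d vanishes below m, the coefficient of zᵐ in (g - U 0)(g + U 0) is 2 d m
    d-step : ∀ m → (∀ t → t ℕ.< m → d t ≈ 0#) → d m ≈ 0#
    d-step m below = two (d m) (begin
      d m + d m
        ≈⟨ solve 1 (λ y → y :+ y := y :* (:1 :+ :1)) refl (d m) ⟩
      d m * (1# + 1#)
        ≈⟨ *-congˡ (sym (+-cong g0 refl)) ⟩
      d m * (g 0 + μ 0 0)
        ≈⟨ *-congˡ (reflexive (P.cong (λ t → g t + μ t 0) (P.sym (ℕP.n∸n≡0 m)))) ⟩
      d m * ((g ⊕ U 0) (m ℕ.∸ m))
        ≈⟨ sym (+-identityˡ _) ⟩
      0# + d m * ((g ⊕ U 0) (m ℕ.∸ m))
        ≈⟨ +-congʳ (sym (sum-zero< m (λ t t<m → trans (*-congʳ (below t t<m)) (zeroˡ _)))) ⟩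
      sum m (λ t → d t * (g ⊕ U 0) (m ℕ.∸ t)) + d m * ((g ⊕ U 0) (m ℕ.∸ m))
        ≈⟨ sym (sum-last m _) ⟩
      sum (suc m) (λ t → d t * (g ⊕ U 0) (m ℕ.∸ t))
        ≈⟨ sum-convolution (g ⊕ ⊝ (U 0)) (g ⊕ U 0) m ⟩
      ((g ⊕ ⊝ (U 0)) ⊛ (g ⊕ U 0)) m
        ≈⟨ SerId.difference-of-squares g (U 0) gg≋U₀U₀ m ⟩
      0# ∎)
    d-vanishes : ∀ n m → m ℕ.≤ n → d m ≈ 0#
    d-vanishes zero zero z≤n = d-step 0 (λ t ())
    d-vanishes (suc n) m m≤sn = d-step m (λ t t<m → d-vanishes n t (ℕP.≤-pred (ℕP.≤-trans t<m m≤sn)))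

-- Cutting a path of length i + j at time i gives
--   μ (i + j) 0 = Σ_m μ i m Λ m μ j m,   Λ m = down 1 ⋯ down m,
-- because reversing the second half turns down steps into up steps.
-- The one-step transfer matrix T then expresses the shifted moments.
module HankelFactorisation {c ℓ} (R : CommutativeRing c ℓ) (a b : CommutativeRing.Carrier R) where

  open import Data.Nat using (zero; suc; s≤s)
  import Data.Nat.Properties as ℕP
  open import Data.Sum using (_⊎_; inj₁; inj₂)
  import Relation.Binary.PropositionalEquality as P
  open import Relation.Nullary using (yes; no)
  open CommutativeRing R
  open import Relation.Binary.Reasoning.Setoid setoid
  open IntegerRingSolver R using (solve; _:=_; _:+_; _:*_)
  open FiniteSums R
  open MotzkinPaths R a b public

  Λ : ℕ → Carrier
  Λ zero = 1#
  Λ (suc m) = down (suc m) * Λ m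

  -- T r m: weight of a single step from height r to height m
  T : ℕ → ℕ → Carrier
  T r m = δ (suc r) m + x * δ r m + down r * δ r (suc m)

  μ-vanishes-beyond : ∀ i N → i ℕ.< N → ∀ r → N ℕ.≤ r → μ i r ≈ 0#
  μ-vanishes-beyond i N i<N r N≤r = μ-unreachable i r (ℕP.<-≤-trans i<N N≤r)

  -- one more step: μ (i+1) m = Σ_r μ i r T r m  (any N > i bounds the heights)
  μ-step : ∀ i N → i ℕ.< N → ∀ m → μ (suc i) m ≈ sum N (λ r → μ i r * T r m)
  μ-step i N i<N m = sym (begin
    sum N (λ r → μ i r * T r m)
      ≈⟨ sum-cong N (λ r → solve 5 (λ u d₁ x d₂ e → u :* (d₁ :+ x :* d₂ :+ e) := d₁ :* u :+ x :* (d₂ :* u) :+ e :* u)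
                             refl (μ i r) (δ (suc r) m) x (δ r m) (down r * δ r (suc m))) ⟩
    sum N (λ r → δ (suc r) m * μ i r + x * (δ r m * μ i r) + down r * δ r (suc m) * μ i r)
      ≈⟨ trans (sum-+ N _ _) (+-congʳ (sum-+ N _ _)) ⟩
    sum N (λ r → δ (suc r) m * μ i r) + sum N (λ r → x * (δ r m * μ i r))
      + sum N (λ r → down r * δ r (suc m) * μ i r)
      ≈⟨ +-cong (+-congˡ (trans (sum-*ˡ N x _) (*-congˡ (sum-δ N m (μ i) (μ-vanishes-beyond i N i<N)))))
                (trans (sum-cong N (λ r → solve 3 (λ l d u → l :* d :* u := d :* (l :* u)) refl (down r) (δ r (suc m)) (μ i r)))
                       (sum-δ N (suc m) (λ r → down r * μ i r)
                          (λ r N≤r → trans (*-congˡ (μ-vanishes-beyond i N i<N r N≤r)) (zeroʳ _)))) ⟩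
    sum N (λ r → δ (suc r) m * μ i r) + x * μ i m + down (suc m) * μ i (suc m)
      ≈⟨ up-step m ⟩
    μ (suc i) m ∎)
    where
    up-step : ∀ m → sum N (λ r → δ (suc r) m * μ i r) + x * μ i m + down (suc m) * μ i (suc m) ≈ μ (suc i) m
    up-step zero = +-congʳ (trans (+-congʳ (sum-zero N (λ r → zeroˡ _))) (+-identityˡ _))
    up-step (suc m') = +-congʳ (+-congʳ (sum-δ N m' (μ i) (μ-vanishes-beyond i N i<N)))

  -- T is symmetrised by Λ: an up step r → r+1 weighted by Λ (r+1) equals the
  -- reverse down step weighted by Λ r.
  T-balance : ∀ r m → T r m * Λ m ≈ T m r * Λ r
  T-balance r m = trans (sym (expand r m)) (trans (+-cong (+-cong (up≈down r m) (level r m)) (sym (up≈down m r)))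
                                                 (expand′ m r))
    where
    expand : ∀ r m → δ (suc r) m * Λ m + x * δ r m * Λ m + down r * δ r (suc m) * Λ m ≈ T r m * Λ m
    expand r m = sym (solve 6 (λ d₁ x d₂ l d₃ L → (d₁ :+ x :* d₂ :+ l :* d₃) :* L := d₁ :* L :+ x :* d₂ :* L :+ l :* d₃ :* L)
                         refl (δ (suc r) m) x (δ r m) (down r) (δ r (suc m)) (Λ m))
    expand′ : ∀ m r → down m * δ m (suc r) * Λ r + x * δ m r * Λ r + δ (suc m) r * Λ r ≈ T m r * Λ r
    expand′ m r = sym (solve 6 (λ d₁ x d₂ l d₃ L → (d₁ :+ x :* d₂ :+ l :* d₃) :* L := l :* d₃ :* L :+ x :* d₂ :* L :+ d₁ :* L)
                           refl (δ (suc m) r) x (δ m r) (down m) (δ m (suc r)) (Λ r))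
    up≈down : ∀ r m → δ (suc r) m * Λ m ≈ down m * δ m (suc r) * Λ r
    up≈down r zero = trans (zeroˡ _) (sym (trans (*-congʳ (zeroʳ _)) (zeroˡ _)))
    up≈down r (suc m) with r ℕ.≟ m
    ... | yes P.refl = trans (*-congʳ (δ-refl r)) (trans (*-identityˡ _)
                         (sym (*-congʳ (trans (*-congˡ (δ-refl r)) (*-identityʳ _)))))
    ... | no r≢m = trans (*-congʳ (δ-≢ r m r≢m)) (trans (zeroˡ _)
                     (sym (trans (*-congʳ (trans (*-congˡ (δ-≢ m r (λ e → r≢m (P.sym e)))) (zeroʳ _))) (zeroˡ _))))
    level : ∀ r m → x * δ r m * Λ m ≈ x * δ m r * Λ r
    level r m with r ℕ.≟ m
    ... | yes P.refl = refl
    ... | no r≢m = trans (*-congʳ (trans (*-congˡ (δ-≢ r m r≢m)) (zeroʳ _))) (trans (zeroˡ _)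
                     (sym (trans (*-congʳ (trans (*-congˡ (δ-≢ m r (λ e → r≢m (P.sym e)))) (zeroʳ _))) (zeroˡ _))))

  Φ : ℕ → ℕ → ℕ → Carrier
  Φ N i j = sum N (λ m → μ i m * Λ m * μ j m)

  Φ-shift : ∀ N i j → i ℕ.< N → j ℕ.< N → Φ N (suc i) j ≈ Φ N i (suc j)
  Φ-shift N i j i<N j<N = begin
    sum N (λ m → μ (suc i) m * Λ m * μ j m)
      ≈⟨ sum-cong N (λ m → *-congʳ (*-congʳ (μ-step i N i<N m))) ⟩
    sum N (λ m → sum N (λ r → μ i r * T r m) * Λ m * μ j m)
      ≈⟨ sum-cong N (λ m → trans (*-congʳ (sym (sum-*ʳ N (Λ m) _))) (sym (sum-*ʳ N (μ j m) _))) ⟩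
    sum N (λ m → sum N (λ r → μ i r * T r m * Λ m * μ j m))
      ≈⟨ sum-swap N N _ ⟩
    sum N (λ r → sum N (λ m → μ i r * T r m * Λ m * μ j m))
      ≈⟨ sum-cong N (λ r → sum-cong N (λ m → begin
           μ i r * T r m * Λ m * μ j m
             ≈⟨ solve 4 (λ u t l v → u :* t :* l :* v := u :* (t :* l) :* v) refl (μ i r) (T r m) (Λ m) (μ j m) ⟩
           μ i r * (T r m * Λ m) * μ j m
             ≈⟨ *-congʳ (*-congˡ (T-balance r m)) ⟩
           μ i r * (T m r * Λ r) * μ j m
             ≈⟨ solve 4 (λ u t l v → u :* (t :* l) :* v := u :* l :* (v :* t)) refl (μ i r) (T m r) (Λ r) (μ j m) ⟩
           μ i r * Λ r * (μ j m * T m r) ∎)) ⟩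
    sum N (λ r → sum N (λ m → μ i r * Λ r * (μ j m * T m r)))
      ≈⟨ sum-cong N (λ r → sum-*ˡ N (μ i r * Λ r) _) ⟩
    sum N (λ r → μ i r * Λ r * sum N (λ m → μ j m * T m r))
      ≈⟨ sum-cong N (λ r → *-congˡ (sym (μ-step j N j<N r))) ⟩
    sum N (λ r → μ i r * Λ r * μ (suc j) r) ∎

  Φ-transfer : ∀ N j i → i ℕ.+ j ℕ.< N → Φ N (i ℕ.+ j) 0 ≈ Φ N i j
  Φ-transfer N zero i h = reflexive (P.cong (λ t → Φ N t 0) (ℕP.+-identityʳ i))
  Φ-transfer N (suc j) i h = begin
    Φ N (i ℕ.+ suc j) 0   ≡⟨ P.cong (λ t → Φ N t 0) (ℕP.+-suc i j) ⟩
    Φ N (suc i ℕ.+ j) 0   ≈⟨ Φ-transfer N j (suc i) (P.subst (ℕ._< N) (ℕP.+-suc i j) h) ⟩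
    Φ N (suc i) j         ≈⟨ Φ-shift N i j (ℕP.≤-<-trans (ℕP.m≤m+n i (suc j)) h)
                                           (ℕP.≤-<-trans (ℕP.≤-trans (ℕP.n≤1+n j) (ℕP.m≤n+m (suc j) i)) h) ⟩
    Φ N i (suc j)         ∎

  μ-gram : ∀ n i j → j ℕ.< n → μ (i ℕ.+ j) 0 ≈ Φ n i j
  μ-gram n i j j<n = begin
    μ (i ℕ.+ j) 0          ≈⟨ sym (Φ-at-0 (i ℕ.+ j)) ⟩
    Φ (suc (i ℕ.+ j)) (i ℕ.+ j) 0 ≈⟨ Φ-transfer (suc (i ℕ.+ j)) j i ℕP.≤-refl ⟩
    Φ (suc (i ℕ.+ j)) i j  ≈⟨ truncate (ℕP.≤-total n (suc (i ℕ.+ j))) ⟩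
    Φ n i j                ∎
    where
    Φ-at-0 : ∀ p → Φ (suc p) p 0 ≈ μ p 0
    Φ-at-0 p = trans (+-cong (trans (*-identityʳ _) (*-identityʳ _)) (sum-zero p (λ m → zeroʳ _))) (+-identityʳ _)
    beyond : ∀ N → j ℕ.< N → ∀ m → N ℕ.≤ m → μ i m * Λ m * μ j m ≈ 0#
    beyond N j<N m N≤m = trans (*-congˡ (μ-vanishes-beyond j N j<N m N≤m)) (zeroʳ _)
    truncate : n ℕ.≤ suc (i ℕ.+ j) ⊎ suc (i ℕ.+ j) ℕ.≤ n → Φ (suc (i ℕ.+ j)) i j ≈ Φ n i j
    truncate (inj₁ n≤N) = sum-extend n _ _ n≤N (beyond n j<n)
    truncate (inj₂ N≤n) = sym (sum-extend _ n _ N≤n (beyond _ (s≤s (ℕP.m≤n+m j i))))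

  -- the (i, j) entry of L X Lᵀ, where L = (μ i r) with i, r < n
  sandwich : ℕ → (ℕ → ℕ → Carrier) → ℕ → ℕ → Carrier
  sandwich n X i j = sum n (λ r → μ i r * sum n (λ r' → X r r' * μ j r'))

  hankel₀ : ∀ n i j → i ℕ.< n → j ℕ.< n → μ (i ℕ.+ j ℕ.+ 0) 0 ≈ sandwich n (λ r r' → δ r r' * Λ r') i j
  hankel₀ n i j i<n j<n = begin
    μ (i ℕ.+ j ℕ.+ 0) 0  ≡⟨ P.cong (λ t → μ t 0) (ℕP.+-identityʳ (i ℕ.+ j)) ⟩
    μ (i ℕ.+ j) 0        ≈⟨ μ-gram n i j j<n ⟩
    Φ n i j              ≈⟨ sum-cong n (λ r → trans (*-assoc _ _ _) (*-congˡ (sym diagonal))) ⟩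
    sandwich n (λ r r' → δ r r' * Λ r') i j ∎
    where
    diagonal : ∀ {r} → sum n (λ r' → (δ r r' * Λ r') * μ j r') ≈ Λ r * μ j r
    diagonal {r} = trans (sum-cong n (λ r' → trans (*-assoc _ _ _) (*-congʳ (δ-sym r r'))))
      (sum-δ n r (λ r' → Λ r' * μ j r') (λ r' n≤r' → trans (*-congˡ (μ-vanishes-beyond j n j<n r' n≤r')) (zeroʳ _)))

  hankel₁ : ∀ n i j → i ℕ.< n → j ℕ.< n → μ (i ℕ.+ j ℕ.+ 1) 0 ≈ sandwich n (λ r r' → T r r' * Λ r') i j
  hankel₁ n i j i<n j<n = begin
    μ (i ℕ.+ j ℕ.+ 1) 0
      ≡⟨ P.cong (λ t → μ t 0) (P.trans (ℕP.+-assoc i j 1) (P.trans (P.cong (i ℕ.+_) (ℕP.+-comm j 1)) (ℕP.+-suc i j))) ⟩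
    μ (suc i ℕ.+ j) 0
      ≈⟨ μ-gram n (suc i) j j<n ⟩
    sum n (λ m → μ (suc i) m * Λ m * μ j m)
      ≈⟨ sum-cong n (λ m → trans (*-congʳ (*-congʳ (μ-step i n i<n m)))
                         (trans (*-congʳ (sym (sum-*ʳ n (Λ m) _))) (sym (sum-*ʳ n (μ j m) _)))) ⟩
    sum n (λ m → sum n (λ r → μ i r * T r m * Λ m * μ j m))
      ≈⟨ sum-swap n n _ ⟩
    sum n (λ r → sum n (λ m → μ i r * T r m * Λ m * μ j m))
      ≈⟨ sum-cong n (λ r → trans (sum-cong n (λ m → solve 4 (λ u t l v → u :* t :* l :* v := u :* (t :* l :* v))
                                                       refl (μ i r) (T r m) (Λ m) (μ j m)))
                                 (sum-*ˡ n (μ i r) _)) ⟩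
    sandwich n (λ r r' → T r r' * Λ r') i j ∎

  -- the kernel of the second shift: (T D Tᵀ) with the sum over one more height
  T²-kernel : ℕ → ℕ → ℕ → Carrier
  T²-kernel n r r' = sum (suc n) (λ m → T r m * Λ m * T r' m)

  hankel₂ : ∀ n i j → i ℕ.< n → j ℕ.< n → μ (i ℕ.+ j ℕ.+ 2) 0 ≈ sandwich n (T²-kernel n) i j
  hankel₂ n i j i<n j<n = begin
    μ (i ℕ.+ j ℕ.+ 2) 0
      ≡⟨ P.cong (λ t → μ t 0) (P.trans (ℕP.+-assoc i j 2) (P.trans (P.cong (i ℕ.+_) (ℕP.+-comm j 2)) (ℕP.+-suc i (suc j)))) ⟩
    μ (suc i ℕ.+ suc j) 0
      ≈⟨ μ-gram (suc n) (suc i) (suc j) (s≤s j<n) ⟩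
    sum (suc n) (λ m → μ (suc i) m * Λ m * μ (suc j) m)
      ≈⟨ sum-cong (suc n) (λ m → *-cong (*-congʳ {Λ m} (μ-step i n i<n m)) (μ-step j n j<n m)) ⟩
    sum (suc n) (λ m → sum n (λ r → μ i r * T r m) * Λ m * sum n (λ r' → μ j r' * T r' m))
      ≈⟨ sum-cong (suc n) expand ⟩
    sum (suc n) (λ m → sum n (λ r → sum n (λ r' → term r r' m)))
      ≈⟨ sum-swap (suc n) n (λ m r → sum n (λ r' → term r r' m)) ⟩
    sum n (λ r → sum (suc n) (λ m → sum n (λ r' → term r r' m)))
      ≈⟨ sum-cong n (λ r → sum-swap (suc n) n (λ m r' → term r r' m)) ⟩
    sum n (λ r → sum n (λ r' → sum (suc n) (λ m → term r r' m)))
      ≈⟨ sum-cong n (λ r → trans (sum-cong n (λ r' →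
           trans (sum-*ˡ (suc n) (μ i r) (λ m → T r m * Λ m * T r' m * μ j r'))
                 (*-congˡ (sum-*ʳ (suc n) (μ j r') (λ m → T r m * Λ m * T r' m)))))
           (sum-*ˡ n (μ i r) (λ r' → T²-kernel n r r' * μ j r'))) ⟩
    sandwich n (T²-kernel n) i j ∎
    where
    term : ℕ → ℕ → ℕ → Carrier
    term r r' m = μ i r * (T r m * Λ m * T r' m * μ j r')
    expand : ∀ m → sum n (λ r → μ i r * T r m) * Λ m * sum n (λ r' → μ j r' * T r' m)
                   ≈ sum n (λ r → sum n (λ r' → term r r' m))
    expand m = begin
      sum n (λ r → μ i r * T r m) * Λ m * sum n (λ r' → μ j r' * T r' m)
        ≈⟨ *-congʳ (sym (sum-*ʳ n (Λ m) (λ r → μ i r * T r m))) ⟩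
      sum n (λ r → μ i r * T r m * Λ m) * sum n (λ r' → μ j r' * T r' m)
        ≈⟨ sym (sum-*ʳ n (sum n (λ r' → μ j r' * T r' m)) (λ r → μ i r * T r m * Λ m)) ⟩
      sum n (λ r → μ i r * T r m * Λ m * sum n (λ r' → μ j r' * T r' m))
        ≈⟨ sum-cong n (λ r → trans (sym (sum-*ˡ n _ _)) (sum-cong n (λ r' →
             solve 5 (λ u t l v t' → u :* t :* l :* (v :* t') := u :* (t :* l :* t' :* v))
               refl (μ i r) (T r m) (Λ m) (μ j r') (T r' m)))) ⟩
      sum n (λ r → sum n (λ r' → term r r' m)) ∎

module Determinants {c ℓ} (R : CommutativeRing c ℓ) where

  open import Data.Nat using (zero; suc)
  open import Data.Fin using (Fin; zero; suc; toℕ; punchIn)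
  open import Data.Vec.Functional using (updateAt)
  import Data.Vec.Functional.Properties as VecF
  open import Relation.Binary.PropositionalEquality as P using (_≡_; _≢_)
  open import Data.Empty using (⊥-elim)
  open import Level using (_⊔_)
  open CommutativeRing R hiding (zero)
  open import Relation.Binary.Reasoning.Setoid setoid
  open IntegerRingSolver R using (solve; _:=_; _:+_; _:*_; :-_; :1)
  open FiniteSums R
  open Series R using (altSum; det)

  Rows : ℕ → ℕ → Set c
  Rows m L = Fin m → Fin L → Carrier

  Mat : ℕ → Set c
  Mat n = Rows n n

  update : ∀ {n} {A : Set c} → (Fin n → A) → Fin n → A → Fin n → A
  update f r a = updateAt f r (λ _ → a)

  update-same : ∀ {n} {A : Set c} (f : Fin n → A) r a → update f r a r ≡ a
  update-same f r a = VecF.updateAt-updates r f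

  update-other : ∀ {n} {A : Set c} (f : Fin n → A) r a i → i ≢ r → update f r a i ≡ f i
  update-other f r a i i≢r = VecF.updateAt-minimal i r f i≢r

  update-map : ∀ {n} {A B : Set c} (φ : A → B) (f : Fin n → A) r a i →
               φ (update f r a i) ≡ update (λ k → φ (f k)) r (φ a) i
  update-map φ f r a = VecF.map-updateAt-local {f = φ} f r P.refl

  update-comm : ∀ {n} {A : Set c} (f : Fin n → A) r r' a a' i → r ≢ r' →
                update (update f r a) r' a' i ≡ update (update f r' a') r a i
  update-comm f r r' a a' i r≢r' = VecF.updateAt-commutes r' r (λ e → r≢r' (P.sym e)) f i

  update-self : ∀ {n} {A : Set c} (f : Fin n → A) r i → update f r (f r) i ≡ f i
  update-self f r = VecF.updateAt-id-local r f P.refl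

  rows-≡ : ∀ {m L} {M M' : Rows m L} → (∀ i → M i ≡ M' i) → ∀ i j → M i j ≈ M' i j
  rows-≡ h i j = reflexive (P.cong (λ row → row j) (h i))

  update-cong : ∀ {m L} (M : Rows m L) r (w w' : Fin L → Carrier) → (∀ k → w k ≈ w' k) →
                ∀ i j → update M r w i j ≈ update M r w' i j
  update-cong M zero w w' h zero j = h j
  update-cong M zero w w' h (suc i) j = refl
  update-cong M (suc r) w w' h zero j = refl
  update-cong M (suc r) w w' h (suc i) j = update-cong (λ k → M (suc k)) r w w' h i j

  δF : ∀ {n} → Fin n → Fin n → Carrier
  δF zero zero = 1#
  δF zero (suc _) = 0#
  δF (suc _) zero = 0#
  δF (suc i) (suc j) = δF i j

  δF-sym : ∀ {n} (i j : Fin n) → δF i j ≈ δF j i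
  δF-sym zero zero = refl
  δF-sym zero (suc j) = refl
  δF-sym (suc i) zero = refl
  δF-sym (suc i) (suc j) = δF-sym i j

  δF-≢ : ∀ {n} (i j : Fin n) → i ≢ j → δF i j ≈ 0#
  δF-≢ zero zero ne = ⊥-elim (ne P.refl)
  δF-≢ zero (suc j) ne = refl
  δF-≢ (suc i) zero ne = refl
  δF-≢ (suc i) (suc j) ne = δF-≢ i j (λ e → ne (P.cong suc e))

  δF-refl : ∀ {n} (i : Fin n) → δF i i ≈ 1#
  δF-refl zero = refl
  δF-refl (suc i) = δF-refl i

  δF-punchIn : ∀ {n} (j : Fin (suc n)) (i k : Fin n) → δF (punchIn j i) (punchIn j k) ≈ δF i k
  δF-punchIn zero i k = refl
  δF-punchIn (suc j) zero zero = refl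
  δF-punchIn (suc j) zero (suc k) = refl
  δF-punchIn (suc j) (suc i) zero = refl
  δF-punchIn (suc j) (suc i) (suc k) = δF-punchIn j i k

  δF-toℕ : ∀ {n} (i j : Fin n) → δF i j ≈ δ (toℕ i) (toℕ j)
  δF-toℕ zero zero = refl
  δF-toℕ zero (suc j) = refl
  δF-toℕ (suc i) zero = refl
  δF-toℕ (suc i) (suc j) = δF-toℕ i j

  identityMat : ∀ n → Mat n
  identityMat n i j = δF i j

  sumFin-+ : ∀ {n} (f g : Fin n → Carrier) → sumFin (λ j → f j + g j) ≈ sumFin f + sumFin g
  sumFin-+ {zero} f g = sym (+-identityˡ _)
  sumFin-+ {suc n} f g = trans (+-congˡ (sumFin-+ {n} (λ j → f (suc j)) (λ j → g (suc j))))
    (solve 4 (λ a b x y → (a :+ b) :+ (x :+ y) := (a :+ x) :+ (b :+ y)) refl _ _ _ _)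

  sumFin-*ˡ : ∀ {n} a (f : Fin n → Carrier) → sumFin (λ j → a * f j) ≈ a * sumFin f
  sumFin-*ˡ {zero} a f = sym (zeroʳ _)
  sumFin-*ˡ {suc n} a f = trans (+-congˡ (sumFin-*ˡ {n} a (λ j → f (suc j)))) (sym (distribˡ _ _ _))

  sumFin-linear : ∀ {n} α β (X Y : Fin n → Carrier) →
                  sumFin (λ j → α * X j + β * Y j) ≈ α * sumFin X + β * sumFin Y
  sumFin-linear α β X Y = trans (sumFin-+ (λ j → α * X j) (λ j → β * Y j)) (+-cong (sumFin-*ˡ α X) (sumFin-*ˡ β Y))

  sumFin-zero : ∀ {n} (f : Fin n → Carrier) → (∀ j → f j ≈ 0#) → sumFin f ≈ 0#
  sumFin-zero {zero} f h = refl
  sumFin-zero {suc n} f h = trans (+-cong (h zero) (sumFin-zero {n} (λ j → f (suc j)) (λ j → h (suc j)))) (+-identityʳ _)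

  sumFin-δ : ∀ {n} (q : Fin n) (f : Fin n → Carrier) → sumFin (λ j → δF q j * f j) ≈ f q
  sumFin-δ {suc n} zero f = trans (+-cong (*-identityˡ _) (sumFin-zero {n} (λ j → 0# * f (suc j)) (λ j → zeroˡ _))) (+-identityʳ _)
  sumFin-δ (suc q) f = trans (+-cong (zeroˡ _) (sumFin-δ q (λ j → f (suc j)))) (+-identityˡ _)

  sumFin-δʳ : ∀ {n} (q : Fin n) (f : Fin n → Carrier) → sumFin (λ j → f j * δF j q) ≈ f q
  sumFin-δʳ q f = trans (sumFin-cong (λ j → trans (*-comm _ _) (*-congʳ (δF-sym j q)))) (sumFin-δ q f)

  altSign : ∀ {n} → Fin n → Carrier
  altSign zero = 1#
  altSign (suc j) = - altSign j

  altSum-cong : ∀ {m} {s s'} {f g : Fin m → Carrier} → s ≈ s' → (∀ j → f j ≈ g j) → altSum s f ≈ altSum s' g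
  altSum-cong {zero} ss fg = refl
  altSum-cong {suc m} ss fg = +-cong (*-cong ss (fg zero)) (altSum-cong (-‿cong ss) (λ j → fg (suc j)))

  altSum≈sumFin : ∀ {m} s (f : Fin m → Carrier) → altSum s f ≈ s * sumFin (λ j → altSign j * f j)
  altSum≈sumFin {zero} s f = sym (zeroʳ _)
  altSum≈sumFin {suc m} s f = begin
    s * f zero + altSum (- s) (λ j → f (suc j))
      ≈⟨ +-congˡ (altSum≈sumFin {m} (- s) (λ j → f (suc j))) ⟩
    s * f zero + (- s) * X
      ≈⟨ solve 3 (λ s a X → s :* a :+ (:- s) :* X := s :* (:1 :* a :+ (:- :1) :* X)) refl s (f zero) X ⟩
    s * (1# * f zero + (- 1#) * X)
      ≈⟨ *-congˡ (+-congˡ (sym (trans (sumFin-cong (λ j → solve 2 (λ g h → (:- g) :* h := (:- :1) :* (g :* h))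
                                                              refl (altSign j) (f (suc j))))
                                      (sumFin-*ˡ {m} (- 1#) (λ j → altSign j * f (suc j)))))) ⟩
    s * (1# * f zero + sumFin (λ j → - altSign j * f (suc j))) ∎
    where
    X = sumFin (λ j → altSign j * f (suc j))

  minor : ∀ {n} → Mat (suc n) → Fin (suc n) → Mat n
  minor M j i k = M (suc i) (punchIn j k)

  det-suc : ∀ n M → det (suc n) M ≈ sumFin (λ j → altSign j * (M zero j * det n (minor M j)))
  det-suc n M = trans (altSum≈sumFin 1# (λ j → M zero j * det n (minor M j))) (*-identityˡ _)

  det-cong : ∀ n {M M' : Mat n} → (∀ i j → M i j ≈ M' i j) → det n M ≈ det n M'
  det-cong zero h = refl
  det-cong (suc n) h = altSum-cong refl (λ j → *-cong (h zero j) (det-cong n (λ i k → h (suc i) (punchIn j k))))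

  sumFin-δ-altSign : ∀ {n} (q : Fin n) (f : Fin n → Carrier) →
                     sumFin (λ j → altSign j * (δF q j * f j)) ≈ altSign q * f q
  sumFin-δ-altSign q f =
    trans (sumFin-cong (λ j → solve 3 (λ s d x → s :* (d :* x) := d :* (s :* x)) refl (altSign j) (δF q j) (f j)))
          (sumFin-δ q (λ j → altSign j * f j))

  det-identity : ∀ n → det n (identityMat n) ≈ 1#
  det-identity zero = refl
  det-identity (suc n) = trans (det-suc n (identityMat (suc n)))
    (trans (sumFin-δ-altSign zero (λ j → det n (minor (identityMat (suc n)) j))) (trans (*-identityˡ _) (det-identity n)))

  -- the permutation matrix moving row j to the top:  rows e_j, e_0, …, ê_j, …
  cyclePerm : ∀ {n} → Fin (suc n) → Mat (suc n)
  cyclePerm j zero k = δF j k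
  cyclePerm j (suc i) k = δF (punchIn j i) k

  det-cyclePerm : ∀ n (j : Fin (suc n)) → det (suc n) (cyclePerm j) ≈ altSign j
  det-cyclePerm n j = begin
    det (suc n) (cyclePerm j)
      ≈⟨ det-suc n (cyclePerm j) ⟩
    sumFin (λ k → altSign k * (δF j k * det n (minor (cyclePerm j) k)))
      ≈⟨ sumFin-δ-altSign j (λ k → det n (minor (cyclePerm j) k)) ⟩
    altSign j * det n (minor (cyclePerm j) j)
      ≈⟨ *-congˡ (trans (det-cong n (λ i k → δF-punchIn j i k)) (det-identity n)) ⟩
    altSign j * 1#
      ≈⟨ *-identityʳ _ ⟩
    altSign j ∎

  -- the properties characterising the determinant among functions of the rows
  Congruent : ∀ {m L} → (Rows m L → Carrier) → Set (c ⊔ ℓ)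
  Congruent F = ∀ M M' → (∀ i j → M i j ≈ M' i j) → F M ≈ F M'

  RowLinear : ∀ {m L} → (Rows m L → Carrier) → Set (c ⊔ ℓ)
  RowLinear {m} {L} F = ∀ (M : Rows m L) r α β (u v : Fin L → Carrier) →
    F (update M r (λ k → α * u k + β * v k)) ≈ α * F (update M r u) + β * F (update M r v)

  Alternating : ∀ {n} → (Mat n → Carrier) → Set (c ⊔ ℓ)
  Alternating {n} F = ∀ (M : Mat n) (r r' : Fin n) → r ≢ r' → (∀ k → M r k ≈ M r' k) → F M ≈ 0#

  det-congruent : ∀ n → Congruent (det n)
  det-congruent n M M' = det-cong n

  det-rowLinear : ∀ n → RowLinear (det n)
  det-rowLinear (suc n) M zero α β u v = begin
    det (suc n) (update M zero w)
      ≈⟨ det-suc n (update M zero w) ⟩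
    sumFin (λ j → altSign j * (w j * D j))
      ≈⟨ sumFin-cong (λ j → solve 6 (λ s a b x y D → s :* ((a :* x :+ b :* y) :* D) := a :* (s :* (x :* D)) :+ b :* (s :* (y :* D)))
                                 refl (altSign j) α β (u j) (v j) (D j)) ⟩
    sumFin (λ j → α * X j + β * Y j)
      ≈⟨ sumFin-linear α β X Y ⟩
    α * sumFin X + β * sumFin Y
      ≈⟨ sym (+-cong (*-congˡ (det-suc n (update M zero u))) (*-congˡ (det-suc n (update M zero v)))) ⟩
    α * det (suc n) (update M zero u) + β * det (suc n) (update M zero v) ∎
    where
    w = λ k → α * u k + β * v k
    D = λ j → det n (minor M j)
    X = λ j → altSign j * (u j * D j)
    Y = λ j → altSign j * (v j * D j)
  det-rowLinear (suc n) M (suc r) α β u v = begin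
    det (suc n) (update M (suc r) w)
      ≈⟨ expand w ⟩
    sumFin (λ j → altSign j * (M zero j * det n (update (minor M j) r (λ k → w (punchIn j k)))))
      ≈⟨ sumFin-cong (λ j → *-congˡ {altSign j} (*-congˡ {M zero j}
           (det-rowLinear n (minor M j) r α β (λ k → u (punchIn j k)) (λ k → v (punchIn j k))))) ⟩
    sumFin (λ j → altSign j * (M zero j * (α * Du j + β * Dv j)))
      ≈⟨ sumFin-cong (λ j → solve 6 (λ s m a b x y → s :* (m :* (a :* x :+ b :* y)) := a :* (s :* (m :* x)) :+ b :* (s :* (m :* y)))
                                 refl (altSign j) (M zero j) α β (Du j) (Dv j)) ⟩
    sumFin (λ j → α * X j + β * Y j)
      ≈⟨ sumFin-linear α β X Y ⟩
    α * sumFin X + β * sumFin Y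
      ≈⟨ sym (+-cong (*-congˡ (expand u)) (*-congˡ (expand v))) ⟩
    α * det (suc n) (update M (suc r) u) + β * det (suc n) (update M (suc r) v) ∎
    where
    w = λ k → α * u k + β * v k
    Du = λ j → det n (update (minor M j) r (λ k → u (punchIn j k)))
    Dv = λ j → det n (update (minor M j) r (λ k → v (punchIn j k)))
    X = λ j → altSign j * (M zero j * Du j)
    Y = λ j → altSign j * (M zero j * Dv j)
    expand : ∀ (w' : Fin (suc n) → Carrier) → det (suc n) (update M (suc r) w')
             ≈ sumFin (λ j → altSign j * (M zero j * det n (update (minor M j) r (λ k → w' (punchIn j k)))))
    expand w' = trans (det-suc n (update M (suc r) w')) (sumFin-cong (λ j → *-congˡ {altSign j} (*-congˡ {M zero j} (det-cong n (λ i k →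
      reflexive (P.cong (λ f → f k) (update-map (λ row k' → row (punchIn j k')) (λ i' → M (suc i')) r w' i)))))))

-- By induction on the
-- size: expand the first row of M; with first row e_j, the remaining rows
-- may have their column j cleared, so F restricts to an alternating form
-- of the minor, which by induction is det (minor M j) times its value at
-- the identity, namely F (cyclePerm j) = (-1)ʲ F I.
module AlternatingForms {c ℓ} (R : CommutativeRing c ℓ) where

  open import Data.Nat using (zero; suc)
  import Data.Nat.Properties as ℕP
  open import Data.Fin using (Fin; zero; suc; toℕ; punchIn; inject₁)
  import Data.Fin.Properties as FinP
  open import Data.Vec.Functional using (insertAt)
  open import Relation.Binary.PropositionalEquality as P using (_≡_; _≢_)
  open import Data.Empty using (⊥-elim)
  open import Data.Unit.Polymorphic using (⊤)
  open import Relation.Binary using (tri<; tri≈; tri>)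
  open import Level using (_⊔_)
  open CommutativeRing R hiding (zero)
  open import Relation.Binary.Reasoning.Setoid setoid
  open IntegerRingSolver R using (solve; _:=_; _:+_; _:*_; :-_; _:-_; :0)
  open FiniteSums R
  open Determinants R
  open Series R using (det)

  module RowLinearity {m L} (F : Rows m L → Carrier) (cg : Congruent F) (ml : RowLinear F) where

    additive : ∀ M r u v → F (update M r (λ k → u k + v k)) ≈ F (update M r u) + F (update M r v)
    additive M r u v = trans (cg _ _ (update-cong M r _ _ (λ k → sym (+-cong (*-identityˡ _) (*-identityˡ _)))))
                             (trans (ml M r 1# 1# u v) (+-cong (*-identityˡ _) (*-identityˡ _)))

    homogeneous : ∀ M r α u → F (update M r (λ k → α * u k)) ≈ α * F (update M r u)
    homogeneous M r α u = trans (cg _ _ (update-cong M r _ _ (λ k → sym (trans (+-congˡ (zeroˡ _)) (+-identityʳ _)))))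
                                (trans (ml M r α 0# u u) (trans (+-congˡ (zeroˡ _)) (+-identityʳ _)))

    zero-row : ∀ M r → F (update M r (λ _ → 0#)) ≈ 0#
    zero-row M r = trans (cg _ _ (update-cong M r _ _ (λ k → sym (zeroˡ (M r k)))))
                         (trans (homogeneous M r 0# (M r)) (zeroˡ _))

    linear-sum : ∀ M r {p} (cf : Fin p → Carrier) (w : Fin p → Fin L → Carrier) →
                 F (update M r (λ k → sumFin (λ t → cf t * w t k))) ≈ sumFin (λ t → cf t * F (update M r (w t)))
    linear-sum M r {zero} cf w = zero-row M r
    linear-sum M r {suc p} cf w = begin
      F (update M r (λ k → cf zero * w zero k + sumFin (λ t → cf (suc t) * w (suc t) k)))
        ≈⟨ cg _ _ (update-cong M r _ _ (λ k → +-congˡ (sym (*-identityˡ _)))) ⟩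
      F (update M r (λ k → cf zero * w zero k + 1# * sumFin (λ t → cf (suc t) * w (suc t) k)))
        ≈⟨ ml M r (cf zero) 1# (w zero) _ ⟩
      cf zero * F (update M r (w zero)) + 1# * F (update M r (λ k → sumFin (λ t → cf (suc t) * w (suc t) k)))
        ≈⟨ +-congˡ (trans (*-identityˡ _) (linear-sum M r (λ t → cf (suc t)) (λ t → w (suc t)))) ⟩
      cf zero * F (update M r (w zero)) + sumFin (λ t → cf (suc t) * F (update M r (w (suc t)))) ∎

  module RowSwap {n} (F : Mat n → Carrier) (cg : Congruent F) (ml : RowLinear F) (a b : Fin n) (a≢b : a ≢ b)
                 (equal-rows : ∀ M → (∀ k → M a k ≈ M b k) → F M ≈ 0#) where
    open RowLinearity F cg ml

    N : Mat n → (Fin n → Carrier) → (Fin n → Carrier) → Mat n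
    N M y z = update (update M a y) b z

    N-diagonal : ∀ M w → F (N M w w) ≈ 0#
    N-diagonal M w = equal-rows _ (λ k → reflexive (P.cong (λ row → row k)
      (P.trans (update-other (update M a w) b w a a≢b) (P.trans (update-same M a w) (P.sym (update-same (update M a w) b w))))))

    additive-at-a : ∀ M u v z → F (N M (λ k → u k + v k) z) ≈ F (N M u z) + F (N M v z)
    additive-at-a M u v z = begin
      F (N M (λ k → u k + v k) z)
        ≈⟨ cg _ _ (rows-≡ (λ i → update-comm M a b _ z i a≢b)) ⟩
      F (update (update M b z) a (λ k → u k + v k))
        ≈⟨ additive (update M b z) a u v ⟩
      F (update (update M b z) a u) + F (update (update M b z) a v)
        ≈⟨ +-cong (cg _ _ (rows-≡ (λ i → update-comm M b a z u i b≢a))) (cg _ _ (rows-≡ (λ i → update-comm M b a z v i b≢a))) ⟩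
      F (N M u z) + F (N M v z) ∎
      where
      b≢a = λ e → a≢b (P.sym e)

    -- expand 0 = F (N M w w) with w = M a + M b
    swap-antisymmetric : ∀ M → F M + F (N M (M b) (M a)) ≈ 0#
    swap-antisymmetric M = begin
      F M + F (N M v u)
        ≈⟨ +-congʳ (cg _ _ (rows-≡ (λ i → P.sym (P.trans (P.cong (λ t → update (update M a u) b t i)
             (P.sym (update-other M a u b (λ e → a≢b (P.sym e))))) (P.trans (update-self (update M a u) b i) (update-self M a i)))))) ⟩
      F (N M u v) + F (N M v u)
        ≈⟨ solve 4 (λ p q r s → p :+ q := (r :+ p) :+ (q :+ s) :- (r :+ s)) refl (F (N M u v)) (F (N M v u)) (F (N M u u)) (F (N M v v)) ⟩
      (F (N M u u) + F (N M u v)) + (F (N M v u) + F (N M v v)) - (F (N M u u) + F (N M v v))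
        ≈⟨ +-cong (+-cong (sym (additive (update M a u) b u v)) (sym (additive (update M a v) b u v)))
                  (-‿cong (+-cong (N-diagonal M u) (N-diagonal M v))) ⟩
      (F (N M u w) + F (N M v w)) - (0# + 0#)
        ≈⟨ +-congʳ (sym (additive-at-a M u v w)) ⟩
      F (N M w w) - (0# + 0#)
        ≈⟨ +-congʳ (N-diagonal M w) ⟩
      0# - (0# + 0#)
        ≈⟨ solve 0 (:0 :- (:0 :+ :0) := :0) refl ⟩
      0# ∎
      where
      u = M a
      v = M b
      w = λ k → u k + v k

  AdjacentAlternating : ∀ {n} → (Mat n → Carrier) → Set (c ⊔ ℓ)
  AdjacentAlternating {zero} F = ⊤
  AdjacentAlternating {suc m} F = ∀ (M : Mat (suc m)) (p : Fin m) → (∀ k → M (inject₁ p) k ≈ M (suc p) k) → F M ≈ 0#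

  -- equal rows at distance d + 1 are brought together by d adjacent swaps
  alternating-at-distance : ∀ {n} (F : Mat n → Carrier) → Congruent F → RowLinear F → AdjacentAlternating F →
    ∀ d (M : Mat n) (a b : Fin n) → toℕ b ≡ suc (toℕ a ℕ.+ d) → (∀ k → M a k ≈ M b k) → F M ≈ 0#
  alternating-at-distance F cg ml adj d M a zero () eq
  alternating-at-distance {suc m} F cg ml adj zero M a (suc p) tb eq =
    adj M p (λ k → trans (reflexive (P.cong (λ t → M t k) p≡a)) (eq k))
    where
    p≡a : inject₁ p ≡ a
    p≡a = FinP.toℕ-injective (P.trans (FinP.toℕ-inject₁ p) (P.trans (ℕP.suc-injective tb) (ℕP.+-identityʳ (toℕ a))))
  alternating-at-distance {suc m} F cg ml adj (suc d) M a (suc p) tb eq = begin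
    F M                   ≈⟨ solve 2 (λ y z → y := (y :+ z) :- z) refl (F M) (F M′) ⟩
    (F M + F M′) - F M′   ≈⟨ +-cong (Swap.swap-antisymmetric M) (-‿cong M′-vanishes) ⟩
    0# - 0#               ≈⟨ -‿inverseʳ 0# ⟩
    0#                    ∎
    where
    b′ : Fin (suc m)
    b′ = inject₁ p
    tb′ : toℕ b′ ≡ suc (toℕ a ℕ.+ d)
    tb′ = P.trans (FinP.toℕ-inject₁ p) (P.trans (ℕP.suc-injective tb) (ℕP.+-suc (toℕ a) d))
    b′≢b : b′ ≢ suc p
    b′≢b e = ℕP.1+n≢n (P.sym (P.trans (P.sym (FinP.toℕ-inject₁ p)) (P.cong toℕ e)))
    a≢b′ : a ≢ b′
    a≢b′ e = ℕP.m≢1+m+n (toℕ a) (P.trans (P.cong toℕ e) tb′)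
    a≢b : a ≢ suc p
    a≢b e = ℕP.m≢1+m+n (toℕ a) (P.trans (P.cong toℕ e) tb)
    module Swap = RowSwap F cg ml b′ (suc p) b′≢b (λ M′ → adj M′ p)
    -- exchange row b with its upper neighbour b′; the copy of row a moves closer
    M′ = Swap.N M (M (suc p)) (M b′)
    row-a : M′ a ≡ M a
    row-a = P.trans (update-other (update M b′ (M (suc p))) (suc p) (M b′) a a≢b) (update-other M b′ (M (suc p)) a a≢b′)
    row-b′ : M′ b′ ≡ M (suc p)
    row-b′ = P.trans (update-other (update M b′ (M (suc p))) (suc p) (M b′) b′ b′≢b) (update-same M b′ (M (suc p)))
    M′-vanishes : F M′ ≈ 0#
    M′-vanishes = alternating-at-distance F cg ml adj d M′ a b′ tb′ (λ k →
      trans (reflexive (P.cong (λ row → row k) row-a)) (trans (eq k) (reflexive (P.cong (λ row → row k) (P.sym row-b′)))))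

  adjacent⇒alternating : ∀ {n} (F : Mat n → Carrier) → Congruent F → RowLinear F → AdjacentAlternating F → Alternating F
  adjacent⇒alternating F cg ml adj M r r' r≢r' eq with ℕP.<-cmp (toℕ r) (toℕ r')
  ... | tri< lt _ _ with ℕP.m≤n⇒∃[o]m+o≡n lt
  ...   | d , e = alternating-at-distance F cg ml adj d M r r' (P.sym e) eq
  adjacent⇒alternating F cg ml adj M r r' r≢r' eq | tri≈ _ e _ = ⊥-elim (r≢r' (FinP.toℕ-injective e))
  adjacent⇒alternating F cg ml adj M r r' r≢r' eq | tri> _ _ gt with ℕP.m≤n⇒∃[o]m+o≡n gt
  ...   | d , e = alternating-at-distance F cg ml adj d M r' r (P.sym e) (λ k → sym (eq k))

  insertZero : ∀ {n} → Fin (suc n) → (Fin n → Carrier) → Fin (suc n) → Carrier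
  insertZero j f = insertAt f j 0#

  -- set entry j to zero
  clearColumn : ∀ {n} → Fin (suc n) → (Fin (suc n) → Carrier) → Fin (suc n) → Carrier
  clearColumn j f = insertZero j (λ k → f (punchIn j k))

  clearColumn-split : ∀ {n} (j : Fin (suc n)) f k → f k ≈ clearColumn j f k + f j * δF j k
  clearColumn-split zero f zero = sym (trans (+-identityˡ _) (*-identityʳ _))
  clearColumn-split zero f (suc k) = sym (trans (+-congˡ (zeroʳ _)) (+-identityʳ _))
  clearColumn-split {suc n} (suc j) f zero = sym (trans (+-congˡ (zeroʳ _)) (+-identityʳ _))
  clearColumn-split {suc n} (suc j) f (suc k) = clearColumn-split j (λ t → f (suc t)) k

  insertZero-cong : ∀ {n} (j : Fin (suc n)) {f g : Fin n → Carrier} → (∀ k → f k ≈ g k) →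
                    ∀ t → insertZero j f t ≈ insertZero j g t
  insertZero-cong zero h zero = refl
  insertZero-cong zero h (suc t) = h t
  insertZero-cong {suc n} (suc j) h zero = h zero
  insertZero-cong {suc n} (suc j) h (suc t) = insertZero-cong j (λ k → h (suc k)) t

  insertZero-linear : ∀ {n} (j : Fin (suc n)) α β (u v : Fin n → Carrier) t →
    insertZero j (λ k → α * u k + β * v k) t ≈ α * insertZero j u t + β * insertZero j v t
  insertZero-linear zero α β u v zero = solve 2 (λ a b → :0 := a :* :0 :+ b :* :0) refl α β
  insertZero-linear zero α β u v (suc t) = refl
  insertZero-linear {suc n} (suc j) α β u v zero = refl
  insertZero-linear {suc n} (suc j) α β u v (suc t) = insertZero-linear j α β (λ k → u (suc k)) (λ k → v (suc k)) t

  insertZero-0 : ∀ {n} (j : Fin (suc n)) t → insertZero j (λ _ → 0#) t ≈ 0#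
  insertZero-0 zero zero = refl
  insertZero-0 zero (suc t) = refl
  insertZero-0 {suc n} (suc j) zero = refl
  insertZero-0 {suc n} (suc j) (suc t) = insertZero-0 j t

  insertZero-δ : ∀ {n} (j : Fin (suc n)) (i : Fin n) t → insertZero j (δF i) t ≈ δF (punchIn j i) t
  insertZero-δ zero i zero = refl
  insertZero-δ zero i (suc t) = refl
  insertZero-δ {suc n} (suc j) zero zero = refl
  insertZero-δ {suc n} (suc j) zero (suc t) = insertZero-0 j t
  insertZero-δ {suc n} (suc j) (suc i) zero = refl
  insertZero-δ {suc n} (suc j) (suc i) (suc t) = insertZero-δ j i t

  withFirstRow : ∀ {m L L'} → (Fin L' → Carrier) → ((Fin L → Carrier) → Fin L' → Carrier) → Rows m L → Rows (suc m) L'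
  withFirstRow h φ X zero = h
  withFirstRow h φ X (suc i) = φ (X i)

  module FirstRowFixed {m L L'} (F : Rows (suc m) L' → Carrier) (cg : Congruent F) (ml : RowLinear F)
           (h : Fin L' → Carrier) (φ : (Fin L → Carrier) → Fin L' → Carrier)
           (φ-cong : ∀ {f g} → (∀ k → f k ≈ g k) → ∀ t → φ f t ≈ φ g t)
           (φ-linear : ∀ α β u v t → φ (λ k → α * u k + β * v k) t ≈ α * φ u t + β * φ v t) where

    G : Rows m L → Carrier
    G X = F (withFirstRow h φ X)

    G-congruent : Congruent G
    G-congruent X X' e = cg _ _ rows
      where
      rows : ∀ i j → withFirstRow h φ X i j ≈ withFirstRow h φ X' i j
      rows zero j = refl
      rows (suc i) j = φ-cong (e i) j

    update-withFirstRow : ∀ (X : Rows m L) r w i j →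
                          withFirstRow h φ (update X r w) i j ≈ update (withFirstRow h φ X) (suc r) (φ w) i j
    update-withFirstRow X r w zero j = refl
    update-withFirstRow X r w (suc i) j = reflexive (P.cong (λ row → row j) (update-map φ X r w i))

    G-rowLinear : RowLinear G
    G-rowLinear X r α β u v = begin
      F (withFirstRow h φ (update X r (λ k → α * u k + β * v k)))
        ≈⟨ cg _ _ (update-withFirstRow X r _) ⟩
      F (update (withFirstRow h φ X) (suc r) (φ (λ k → α * u k + β * v k)))
        ≈⟨ cg _ _ (update-cong _ (suc r) _ _ (φ-linear α β u v)) ⟩
      F (update (withFirstRow h φ X) (suc r) (λ t → α * φ u t + β * φ v t))
        ≈⟨ ml _ (suc r) α β (φ u) (φ v) ⟩
      α * F (update (withFirstRow h φ X) (suc r) (φ u)) + β * F (update (withFirstRow h φ X) (suc r) (φ v))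
        ≈⟨ sym (+-cong (*-congˡ (cg _ _ (update-withFirstRow X r u))) (*-congˡ (cg _ _ (update-withFirstRow X r v)))) ⟩
      α * G (update X r u) + β * G (update X r v) ∎

  withFirstRow-alternating : ∀ {n} (F : Mat (suc n) → Carrier) → Alternating F →
    (h : Fin (suc n) → Carrier) (φ : (Fin n → Carrier) → Fin (suc n) → Carrier) →
    (∀ {f g} → (∀ k → f k ≈ g k) → ∀ t → φ f t ≈ φ g t) → Alternating (λ X → F (withFirstRow h φ X))
  withFirstRow-alternating F alt h φ φ-cong X r r' ne eq = alt _ (suc r) (suc r') (λ e → ne (FinP.suc-injective e)) (φ-cong eq)

  -- If a row-linear K vanishes whenever some row is e_j, then column j of
  -- its argument is irrelevant: split each row as (row with entry j
  -- cleared) + (entry j)·e_j and use linearity, one row at a time.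
  clear-column : ∀ {L} (j : Fin (suc L)) m (K : Rows m (suc L) → Carrier) → Congruent K → RowLinear K →
                 (∀ X i → K (update X i (δF j)) ≈ 0#) → ∀ X → K X ≈ K (λ i → clearColumn j (X i))
  clear-column j zero K cg ml vanishes X = cg _ _ (λ ())
  clear-column {L} j (suc m) K cg ml vanishes X = begin
    K X
      ≈⟨ cg _ _ split-first-row ⟩
    K (update X zero (λ k → 1# * h k + X zero j * δF j k))
      ≈⟨ ml X zero 1# (X zero j) h (δF j) ⟩
    1# * K (update X zero h) + X zero j * K (update X zero (δF j))
      ≈⟨ trans (+-cong (*-identityˡ _) (trans (*-congˡ (vanishes X zero)) (zeroʳ _))) (+-identityʳ _) ⟩
    K (update X zero h)
      ≈⟨ cg _ _ (λ where zero k → refl ; (suc i) k → refl) ⟩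
    Rest.G (λ i → X (suc i))
      ≈⟨ clear-column j m Rest.G Rest.G-congruent Rest.G-rowLinear rest-vanishes (λ i → X (suc i)) ⟩
    Rest.G (λ i → clearColumn j (X (suc i)))
      ≈⟨ cg _ _ (λ where zero k → refl ; (suc i) k → refl) ⟩
    K (λ i → clearColumn j (X i)) ∎
    where
    h = clearColumn j (X zero)
    module Rest = FirstRowFixed {m} {suc L} {suc L} K cg ml h (λ f → f) (λ e t → e t) (λ α β u v t → refl)
    rest-vanishes : ∀ Y i → Rest.G (update Y i (δF j)) ≈ 0#
    rest-vanishes Y i = trans (cg _ _ (Rest.update-withFirstRow Y i (δF j))) (vanishes _ (suc i))
    split-first-row : ∀ i k → X i k ≈ update X zero (λ k → 1# * h k + X zero j * δF j k) i k
    split-first-row zero k = trans (clearColumn-split j (X zero) k) (+-congʳ (sym (*-identityˡ _)))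
    split-first-row (suc i) k = refl

  -- Given uniqueness in size n + 1, an alternating form of size n + 2 takes
  -- the value (-1)ʲ F I on cyclePerm j: swapping the first two rows of
  -- cyclePerm (j + 1) gives e₀ on top of a copy of cyclePerm j.
  form-on-cyclePerm : ∀ n (F : Mat (suc n) → Carrier) → Congruent F → RowLinear F → Alternating F →
    (∀ (H : Mat n → Carrier) → Congruent H → RowLinear H → Alternating H → ∀ X → H X ≈ det n X * H (identityMat n)) →
    ∀ j → F (cyclePerm j) ≈ altSign j * F (identityMat (suc n))
  form-on-cyclePerm n F cg ml alt unique zero = trans (cg _ _ (λ where zero k → refl ; (suc i) k → refl)) (sym (*-identityˡ _))
  form-on-cyclePerm (suc n) F cg ml alt unique (suc j) = begin
    F (cyclePerm (suc j))
      ≈⟨ solve 2 (λ y z → y := (y :+ z) :- z) refl (F (cyclePerm (suc j))) (F swapped) ⟩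
    (F (cyclePerm (suc j)) + F swapped) - F swapped
      ≈⟨ +-cong (Swap.swap-antisymmetric (cyclePerm (suc j))) (-‿cong (cg _ _ swapped-rows)) ⟩
    0# - Below.G (cyclePerm j)
      ≈⟨ +-congˡ (-‿cong (unique Below.G Below.G-congruent Below.G-rowLinear
           (withFirstRow-alternating F alt (δF zero) (insertZero zero) (insertZero-cong zero)) (cyclePerm j))) ⟩
    0# - det (suc n) (cyclePerm j) * Below.G (identityMat (suc n))
      ≈⟨ +-congˡ (-‿cong (*-cong (det-cyclePerm n j) (cg _ _ identity-rows))) ⟩
    0# - altSign j * F (identityMat (suc (suc n)))
      ≈⟨ solve 2 (λ s f → :0 :- s :* f := (:- s) :* f) refl (altSign j) (F (identityMat (suc (suc n)))) ⟩
    - altSign j * F (identityMat (suc (suc n))) ∎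
    where
    module Swap = RowSwap F cg ml zero (suc zero) (λ ()) (λ M → alt M zero (suc zero) (λ ()))
    swapped = Swap.N (cyclePerm (suc j)) (cyclePerm (suc j) (suc zero)) (cyclePerm (suc j) zero)
    module Below = FirstRowFixed {suc n} {suc n} {suc (suc n)} F cg ml (δF zero) (insertZero zero)
                                 (insertZero-cong zero) (insertZero-linear zero)
    swapped-rows : ∀ i k → swapped i k ≈ withFirstRow (δF zero) (insertZero zero) (cyclePerm j) i k
    swapped-rows zero k = refl
    swapped-rows (suc zero) zero = refl
    swapped-rows (suc zero) (suc k) = refl
    swapped-rows (suc (suc i)) zero = refl
    swapped-rows (suc (suc i)) (suc k) = refl
    identity-rows : ∀ i k → withFirstRow (δF zero) (insertZero zero) (identityMat (suc n)) i k ≈ identityMat (suc (suc n)) i k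
    identity-rows zero k = refl
    identity-rows (suc i) zero = refl
    identity-rows (suc i) (suc k) = refl

  -- F with first row e_j, as an alternating form of the minor
  module FirstRowUnit {n} (F : Mat (suc n) → Carrier) (cg : Congruent F) (ml : RowLinear F) (alt : Alternating F)
                      (j : Fin (suc n)) where
    open FirstRowFixed {n} {n} {suc n} F cg ml (δF j) (insertZero j) (insertZero-cong j) (insertZero-linear j) public

    G-alternating : Alternating G
    G-alternating = withFirstRow-alternating F alt (δF j) (insertZero j) (insertZero-cong j)

    first-row-unit : ∀ (M : Mat (suc n)) → F (update M zero (δF j)) ≈ G (minor M j)
    first-row-unit M = begin
      F (update M zero (δF j))
        ≈⟨ cg _ _ (λ where zero k → refl ; (suc i) k → refl) ⟩
      Others.G (λ i → M (suc i))
        ≈⟨ clear-column j n Others.G Others.G-congruent Others.G-rowLinear others-vanish (λ i → M (suc i)) ⟩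
      Others.G (λ i → clearColumn j (M (suc i)))
        ≈⟨ cg _ _ (λ where zero k → refl ; (suc i) k → refl) ⟩
      G (minor M j) ∎
      where
      module Others = FirstRowFixed {n} {suc n} {suc n} F cg ml (δF j) (λ f → f) (λ e t → e t) (λ α β u v t → refl)
      others-vanish : ∀ X i → Others.G (update X i (δF j)) ≈ 0#
      others-vanish X i = trans (cg _ _ (Others.update-withFirstRow X i (δF j)))
        (alt _ zero (suc i) (λ ()) (λ k → reflexive (P.cong (λ row → row k) (P.sym (update-same X i (δF j))))))

    G-identity : G (identityMat n) ≈ F (cyclePerm j)
    G-identity = cg _ _ (λ where zero k → refl ; (suc i) k → insertZero-δ j i k)

  alternating-form-unique : ∀ n (F : Mat n → Carrier) → Congruent F → RowLinear F → Alternating F →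
                            ∀ M → F M ≈ det n M * F (identityMat n)
  alternating-form-unique zero F cg ml alt M = trans (cg _ _ (λ ())) (sym (*-identityˡ _))
  alternating-form-unique (suc n) F cg ml alt M = begin
    F M
      ≈⟨ cg _ _ (λ where zero k → sym (sumFin-δʳ k (M zero)) ; (suc i) k → refl) ⟩
    F (update M zero (λ k → sumFin (λ t → M zero t * δF t k)))
      ≈⟨ RowLinearity.linear-sum F cg ml M zero (M zero) δF ⟩
    sumFin (λ t → M zero t * F (update M zero (δF t)))
      ≈⟨ sumFin-cong (λ t → *-congˡ {M zero t} (unit-first-row t)) ⟩
    sumFin (λ t → M zero t * (det n (minor M t) * (altSign t * FI)))
      ≈⟨ sumFin-cong (λ t → solve 4 (λ m d s f → m :* (d :* (s :* f)) := f :* (s :* (m :* d)))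
                                   refl (M zero t) (det n (minor M t)) (altSign t) FI) ⟩
    sumFin (λ t → FI * (altSign t * (M zero t * det n (minor M t))))
      ≈⟨ trans (sumFin-*ˡ FI (λ t → altSign t * (M zero t * det n (minor M t)))) (*-comm _ _) ⟩
    sumFin (λ t → altSign t * (M zero t * det n (minor M t))) * FI
      ≈⟨ *-congʳ (sym (det-suc n M)) ⟩
    det (suc n) M * FI ∎
    where
    FI = F (identityMat (suc n))
    unit-first-row : ∀ j → F (update M zero (δF j)) ≈ det n (minor M j) * (altSign j * FI)
    unit-first-row j = begin
      F (update M zero (δF j))
        ≈⟨ U.first-row-unit M ⟩
      U.G (minor M j)
        ≈⟨ alternating-form-unique n U.G U.G-congruent U.G-rowLinear U.G-alternating (minor M j) ⟩
      det n (minor M j) * U.G (identityMat n)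
        ≈⟨ *-congˡ (trans U.G-identity (form-on-cyclePerm n F cg ml alt (alternating-form-unique n) j)) ⟩
      det n (minor M j) * (altSign j * FI) ∎
      where module U = FirstRowUnit F cg ml alt j

-- det (Mᵀ) = det M and det (X Y) = det X · det Y, via the uniqueness of
-- alternating forms.  For the transpose, det ∘ transpose is linear in rows
-- (det is linear in columns) and vanishes on matrices with two equal
-- adjacent rows (Laplace expansion of a matrix with two equal adjacent
-- columns cancels in pairs); it is therefore alternating, hence det M times
-- its value 1 at the identity.
module DeterminantLaws {c ℓ} (R : CommutativeRing c ℓ) where

  open import Data.Nat using (zero; suc)
  open import Data.Fin as Fin using (Fin; zero; suc; punchIn; punchOut; inject₁)
  import Data.Fin.Properties as FinP
  open import Relation.Binary.PropositionalEquality as P using (_≡_; _≢_)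
  open import Data.Product using (Σ; _,_; _×_)
  open import Data.Sum using (_⊎_; inj₁; inj₂)
  open import Data.Empty using (⊥-elim)
  open import Relation.Nullary using (yes; no)
  open CommutativeRing R hiding (zero)
  open import Relation.Binary.Reasoning.Setoid setoid
  open IntegerRingSolver R using (solve; _:=_; _:+_; _:*_; :-_; :0)
  open FiniteSums R
  open Determinants R
  open AlternatingForms R
  open Series R using (altSum; det)

  setColumn : ∀ {n} → Mat n → Fin n → (Fin n → Carrier) → Mat n
  setColumn X c w i k = update (X i) c (w i) k

  update-punchIn : ∀ {n} {A : Set c} (f : Fin (suc n) → A) (cc j : Fin (suc n)) (ne : j ≢ cc) a k →
                   update f cc a (punchIn j k) ≡ update (λ t → f (punchIn j t)) (punchOut ne) a k
  update-punchIn f zero zero ne a k = ⊥-elim (ne P.refl)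
  update-punchIn f (suc cc) zero ne a k = P.refl
  update-punchIn {suc n} f zero (suc j) ne a zero = P.refl
  update-punchIn {suc n} f zero (suc j) ne a (suc k) = P.refl
  update-punchIn {suc n} f (suc cc) (suc j) ne a zero = P.refl
  update-punchIn {suc n} f (suc cc) (suc j) ne a (suc k) =
    update-punchIn (λ t → f (suc t)) cc j (λ e → ne (P.cong suc e)) a k

  det-columnLinear : ∀ n (X : Mat n) cc α β (u v : Fin n → Carrier) →
    det n (setColumn X cc (λ i → α * u i + β * v i)) ≈ α * det n (setColumn X cc u) + β * det n (setColumn X cc v)
  det-columnLinear (suc n) X cc α β u v = begin
    det (suc n) (setColumn X cc w)
      ≈⟨ det-suc n (setColumn X cc w) ⟩
    sumFin (λ j → altSign j * term w j)
      ≈⟨ sumFin-cong (λ j → trans (*-congˡ (term-linear j))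
           (solve 5 (λ s a b x y → s :* (a :* x :+ b :* y) := a :* (s :* x) :+ b :* (s :* y)) refl (altSign j) α β (term u j) (term v j))) ⟩
    sumFin (λ j → α * (altSign j * term u j) + β * (altSign j * term v j))
      ≈⟨ sumFin-linear α β (λ j → altSign j * term u j) (λ j → altSign j * term v j) ⟩
    α * sumFin (λ j → altSign j * term u j) + β * sumFin (λ j → altSign j * term v j)
      ≈⟨ sym (+-cong (*-congˡ (det-suc n (setColumn X cc u))) (*-congˡ (det-suc n (setColumn X cc v)))) ⟩
    α * det (suc n) (setColumn X cc u) + β * det (suc n) (setColumn X cc v) ∎
    where
    w = λ i → α * u i + β * v i
    term : (Fin (suc n) → Carrier) → Fin (suc n) → Carrier
    term w' j = setColumn X cc w' zero j * det n (minor (setColumn X cc w') j)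
    term-linear : ∀ j → term w j ≈ α * term u j + β * term v j
    term-linear j with j Fin.≟ cc
    ... | yes P.refl = begin
          update (X zero) j (w zero) j * det n (minor (setColumn X j w) j)
            ≈⟨ *-cong (reflexive (update-same (X zero) j (w zero))) (det-cong n (unchanged w)) ⟩
          w zero * D
            ≈⟨ solve 5 (λ a b x y D → (a :* x :+ b :* y) :* D := a :* (x :* D) :+ b :* (y :* D)) refl α β (u zero) (v zero) D ⟩
          α * (u zero * D) + β * (v zero * D)
            ≈⟨ sym (+-cong (*-congˡ (*-cong (reflexive (update-same (X zero) j (u zero))) (det-cong n (unchanged u))))
                           (*-congˡ (*-cong (reflexive (update-same (X zero) j (v zero))) (det-cong n (unchanged v))))) ⟩
          α * term u j + β * term v j ∎
      where
      D = det n (λ i k → X (suc i) (punchIn j k))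
      unchanged : ∀ w' i k → minor (setColumn X j w') j i k ≈ X (suc i) (punchIn j k)
      unchanged w' i k = reflexive (update-other (X (suc i)) j (w' (suc i)) (punchIn j k) (FinP.punchInᵢ≢i j k))
    ... | no j≢c = begin
          update (X zero) cc (w zero) j * det n (minor (setColumn X cc w) j)
            ≈⟨ *-cong (reflexive (update-other (X zero) cc (w zero) j j≢c)) (det-cong n (moved w)) ⟩
          X zero j * det n (setColumn (minor X j) c' (λ i → w (suc i)))
            ≈⟨ *-congˡ (det-columnLinear n (minor X j) c' α β (λ i → u (suc i)) (λ i → v (suc i))) ⟩
          X zero j * (α * Du + β * Dv)
            ≈⟨ solve 5 (λ m a b x y → m :* (a :* x :+ b :* y) := a :* (m :* x) :+ b :* (m :* y)) refl (X zero j) α β Du Dv ⟩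
          α * (X zero j * Du) + β * (X zero j * Dv)
            ≈⟨ sym (+-cong (*-congˡ (*-cong (reflexive (update-other (X zero) cc (u zero) j j≢c)) (det-cong n (moved u))))
                           (*-congˡ (*-cong (reflexive (update-other (X zero) cc (v zero) j j≢c)) (det-cong n (moved v))))) ⟩
          α * term u j + β * term v j ∎
      where
      c' = punchOut j≢c
      Du = det n (setColumn (minor X j) c' (λ i → u (suc i)))
      Dv = det n (setColumn (minor X j) c' (λ i → v (suc i)))
      moved : ∀ w' i k → minor (setColumn X cc w') j i k ≈ setColumn (minor X j) c' (λ i → w' (suc i)) i k
      moved w' i k = reflexive (update-punchIn (X (suc i)) cc j j≢c (w' (suc i)) k)

  altSum-zero : ∀ {m} s (f : Fin m → Carrier) → (∀ j → f j ≈ 0#) → altSum s f ≈ 0#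
  altSum-zero {zero} s f h = refl
  altSum-zero {suc m} s f h =
    trans (+-cong (trans (*-congˡ (h zero)) (zeroʳ _)) (altSum-zero (- s) (λ j → f (suc j)) (λ j → h (suc j)))) (+-identityʳ _)

  altSum-pair-cancel : ∀ {m} (p : Fin m) s (f : Fin (suc m) → Carrier) →
    (∀ j → j ≢ inject₁ p → j ≢ suc p → f j ≈ 0#) → f (inject₁ p) ≈ f (suc p) → altSum s f ≈ 0#
  altSum-pair-cancel {suc m} zero s f h e = begin
    s * f zero + ((- s) * f (suc zero) + altSum (- - s) (λ j → f (suc (suc j))))
      ≈⟨ +-cong (*-congˡ e) (+-congˡ (altSum-zero (- - s) _
           (λ j → h (suc (suc j)) (λ ()) (λ q → FinP.0≢1+n (P.sym (FinP.suc-injective q)))))) ⟩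
    s * f (suc zero) + ((- s) * f (suc zero) + 0#)
      ≈⟨ solve 2 (λ s x → s :* x :+ ((:- s) :* x :+ :0) := :0) refl s (f (suc zero)) ⟩
    0# ∎
  altSum-pair-cancel {suc m} (suc p) s f h e = trans (+-cong (trans (*-congˡ (h zero (λ ()) (λ ()))) (zeroʳ _))
      (altSum-pair-cancel p (- s) (λ j → f (suc j))
         (λ j n₁ n₂ → h (suc j) (λ q → n₁ (FinP.suc-injective q)) (λ q → n₂ (FinP.suc-injective q))) e)) (+-identityʳ _)

  punchIn-avoiding-pair : ∀ {m} (j : Fin (suc (suc m))) (p : Fin (suc m)) → j ≢ inject₁ p → j ≢ suc p →
    Σ (Fin m) λ p' → (punchIn j (inject₁ p') ≡ inject₁ p) × (punchIn j (suc p') ≡ suc p)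
  punchIn-avoiding-pair zero zero ne₁ ne₂ = ⊥-elim (ne₁ P.refl)
  punchIn-avoiding-pair {suc m} zero (suc p) ne₁ ne₂ = p , P.refl , P.refl
  punchIn-avoiding-pair (suc zero) zero ne₁ ne₂ = ⊥-elim (ne₂ P.refl)
  punchIn-avoiding-pair {suc m} (suc (suc j)) zero ne₁ ne₂ = zero , P.refl , P.refl
  punchIn-avoiding-pair {suc m} (suc j) (suc p) ne₁ ne₂
    with punchIn-avoiding-pair {m} j p (λ q → ne₁ (P.cong suc q)) (λ q → ne₂ (P.cong suc q))
  ... | p' , e₁ , e₂ = suc p' , P.cong suc e₁ , P.cong suc e₂

  punchIn-pair : ∀ {m} (p k : Fin m) → (punchIn (inject₁ p) k ≡ punchIn (suc p) k)
                 ⊎ ((punchIn (inject₁ p) k ≡ suc p) × (punchIn (suc p) k ≡ inject₁ p))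
  punchIn-pair zero zero = inj₂ (P.refl , P.refl)
  punchIn-pair zero (suc k) = inj₁ P.refl
  punchIn-pair (suc p) zero = inj₁ P.refl
  punchIn-pair (suc p) (suc k) with punchIn-pair p k
  ... | inj₁ e = inj₁ (P.cong suc e)
  ... | inj₂ (e₁ , e₂) = inj₂ (P.cong suc e₁ , P.cong suc e₂)

  det-adjacent-columns : ∀ m (M : Mat (suc m)) (p : Fin m) → (∀ i → M i (inject₁ p) ≈ M i (suc p)) → det (suc m) M ≈ 0#
  det-adjacent-columns (suc m) M p h = altSum-pair-cancel p 1# (λ j → M zero j * det (suc m) (minor M j)) other pair
    where
    other : ∀ j → j ≢ inject₁ p → j ≢ suc p → M zero j * det (suc m) (minor M j) ≈ 0#
    other j n₁ n₂ with punchIn-avoiding-pair {m} j p n₁ n₂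
    ... | p' , e₁ , e₂ = trans (*-congˡ (det-adjacent-columns m (minor M j) p' (λ i →
            trans (reflexive (P.cong (M (suc i)) e₁)) (trans (h (suc i)) (reflexive (P.cong (M (suc i)) (P.sym e₂)))))))
          (zeroʳ _)
    pair : M zero (inject₁ p) * det (suc m) (minor M (inject₁ p)) ≈ M zero (suc p) * det (suc m) (minor M (suc p))
    pair = *-cong (h zero) (det-cong (suc m) same-minor)
      where
      same-minor : ∀ i k → M (suc i) (punchIn (inject₁ p) k) ≈ M (suc i) (punchIn (suc p) k)
      same-minor i k with punchIn-pair p k
      ... | inj₁ e = reflexive (P.cong (M (suc i)) e)
      ... | inj₂ (e₁ , e₂) = trans (reflexive (P.cong (M (suc i)) e₁))
                                   (trans (sym (h (suc i))) (reflexive (P.cong (M (suc i)) (P.sym e₂))))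

  transpose : ∀ {n} → Mat n → Mat n
  transpose M i j = M j i

  detᵀ : ∀ n → Mat n → Carrier
  detᵀ n M = det n (transpose M)

  detᵀ-congruent : ∀ n → Congruent (detᵀ n)
  detᵀ-congruent n M M' e = det-cong n (λ i j → e j i)

  detᵀ-rowLinear : ∀ n → RowLinear (detᵀ n)
  detᵀ-rowLinear n M r α β u v = begin
    det n (transpose (update M r (λ k → α * u k + β * v k)))
      ≈⟨ det-cong n (as-column _) ⟩
    det n (setColumn (transpose M) r (λ k → α * u k + β * v k))
      ≈⟨ det-columnLinear n (transpose M) r α β u v ⟩
    α * det n (setColumn (transpose M) r u) + β * det n (setColumn (transpose M) r v)
      ≈⟨ sym (+-cong (*-congˡ (det-cong n (as-column u))) (*-congˡ (det-cong n (as-column v)))) ⟩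
    α * detᵀ n (update M r u) + β * detᵀ n (update M r v) ∎
    where
    as-column : ∀ w i j → transpose (update M r w) i j ≈ setColumn (transpose M) r w i j
    as-column w i j = reflexive (update-map (λ row → row i) M r w j)

  detᵀ-alternating : ∀ n → Alternating (detᵀ n)
  detᵀ-alternating n = adjacent⇒alternating (detᵀ n) (detᵀ-congruent n) (detᵀ-rowLinear n) (adjacent n)
    where
    adjacent : ∀ n → AdjacentAlternating (detᵀ n)
    adjacent zero = _
    adjacent (suc m) M p h = det-adjacent-columns m (transpose M) p h

  det-transpose : ∀ n M → det n (transpose M) ≈ det n M
  det-transpose n M = begin
    detᵀ n M
      ≈⟨ alternating-form-unique n (detᵀ n) (detᵀ-congruent n) (detᵀ-rowLinear n) (detᵀ-alternating n) M ⟩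
    det n M * det n (transpose (identityMat n))
      ≈⟨ *-congˡ (trans (det-cong n (λ i j → δF-sym j i)) (det-identity n)) ⟩
    det n M * 1#
      ≈⟨ *-identityʳ _ ⟩
    det n M ∎

  det-alternating : ∀ n → Alternating (det n)
  det-alternating n M r r' ne eq = trans (sym (det-transpose n M)) (detᵀ-alternating n M r r' ne eq)

  -- matrix product; X ↦ det (X Y) is an alternating form, with value det Y at I
  infixl 7 _⊙_
  _⊙_ : ∀ {n} → Mat n → Mat n → Mat n
  (X ⊙ Y) i j = sumFin (λ t → X i t * Y t j)

  det-mul : ∀ n X Y → det n (X ⊙ Y) ≈ det n X * det n Y
  det-mul n X Y = trans (alternating-form-unique n F F-congruent F-rowLinear F-alternating X)
                        (*-congˡ (det-cong n (λ i j → sumFin-δ i (λ t → Y t j))))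
    where
    F : Mat n → Carrier
    F X = det n (X ⊙ Y)
    F-congruent : Congruent F
    F-congruent X X' e = det-cong n (λ i j → sumFin-cong (λ t → *-congʳ (e i t)))
    φ : (Fin n → Carrier) → Fin n → Carrier
    φ row j = sumFin (λ t → row t * Y t j)
    update-⊙ : ∀ (X : Mat n) r w i j → (update X r w ⊙ Y) i j ≈ update (X ⊙ Y) r (φ w) i j
    update-⊙ X r w i j = reflexive (P.cong (λ row → row j) (update-map φ X r w i))
    F-rowLinear : RowLinear F
    F-rowLinear X r α β u v = begin
      det n (update X r (λ k → α * u k + β * v k) ⊙ Y)
        ≈⟨ det-cong n (update-⊙ X r _) ⟩
      det n (update (X ⊙ Y) r (φ (λ k → α * u k + β * v k)))
        ≈⟨ det-cong n (update-cong (X ⊙ Y) r _ _ φ-linear) ⟩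
      det n (update (X ⊙ Y) r (λ j → α * φ u j + β * φ v j))
        ≈⟨ det-rowLinear n (X ⊙ Y) r α β (φ u) (φ v) ⟩
      α * det n (update (X ⊙ Y) r (φ u)) + β * det n (update (X ⊙ Y) r (φ v))
        ≈⟨ sym (+-cong (*-congˡ (det-cong n (update-⊙ X r u))) (*-congˡ (det-cong n (update-⊙ X r v)))) ⟩
      α * F (update X r u) + β * F (update X r v) ∎
      where
      φ-linear : ∀ j → φ (λ k → α * u k + β * v k) j ≈ α * φ u j + β * φ v j
      φ-linear j = trans (sumFin-cong (λ t → solve 5 (λ a b x y z → (a :* x :+ b :* y) :* z := a :* (x :* z) :+ b :* (y :* z))
                                                   refl α β (u t) (v t) (Y t j)))
                         (sumFin-linear α β (λ t → u t * Y t j) (λ t → v t * Y t j))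
    F-alternating : Alternating F
    F-alternating X r r' ne eq = det-alternating n (X ⊙ Y) r r' ne (λ k → sumFin-cong (λ t → *-congʳ (eq t)))

module SpecialDeterminants {c ℓ} (R : CommutativeRing c ℓ) where

  open import Data.Nat using (zero; suc; z≤n; s≤s)
  open import Data.Fin as Fin using (Fin; zero; suc; toℕ; punchIn; inject₁; fromℕ)
  import Data.Fin.Properties as FinP
  open import Relation.Binary.PropositionalEquality as P using (_≡_)
  open import Relation.Nullary using (yes; no)
  open CommutativeRing R hiding (zero)
  open import Relation.Binary.Reasoning.Setoid setoid
  open IntegerRingSolver R using (solve; _:=_; _:+_; _:*_; :-_; _:-_; :0; :1)
  open FiniteSums R
  open Determinants R
  open AlternatingForms R using (module RowLinearity)
  open DeterminantLaws R using (transpose; det-transpose)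
  open Series R using (det)

  det-lowerTriangular : ∀ n (M : Mat n) → (∀ i j → toℕ i ℕ.< toℕ j → M i j ≈ 0#) → det n M ≈ prodFin (λ i → M i i)
  det-lowerTriangular zero M h = refl
  det-lowerTriangular (suc n) M h = begin
    det (suc n) M
      ≈⟨ det-suc n M ⟩
    altSign (Fin.zero {n}) * (M zero zero * det n (minor M zero))
      + sumFin (λ j → altSign (suc j) * (M zero (suc j) * det n (minor M (suc j))))
      ≈⟨ +-cong (*-identityˡ _) (sumFin-zero _ (λ j →
           trans (*-congˡ (trans (*-congʳ (h zero (suc j) (s≤s z≤n))) (zeroˡ _))) (zeroʳ _))) ⟩
    M zero zero * det n (minor M zero) + 0#
      ≈⟨ +-identityʳ _ ⟩
    M zero zero * det n (minor M zero)
      ≈⟨ *-congˡ (det-lowerTriangular n (minor M zero) (λ i j lt → h (suc i) (suc j) (s≤s lt))) ⟩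
    M zero zero * prodFin (λ i → M (suc i) (suc i)) ∎

  det-zero-row : ∀ n (M : Mat n) r → (∀ k → M r k ≈ 0#) → det n M ≈ 0#
  det-zero-row n M r h = trans (det-cong n as-update)
    (RowLinearity.zero-row (det n) (det-congruent n) (det-rowLinear n) M r)
    where
    as-update : ∀ i k → M i k ≈ update M r (λ _ → 0#) i k
    as-update i k with i Fin.≟ r
    ... | yes P.refl = trans (h k) (sym (reflexive (P.cong (λ row → row k) (update-same M i (λ _ → 0#)))))
    ... | no ne = sym (reflexive (P.cong (λ row → row k) (update-other M r (λ _ → 0#) i ne)))

  det-zero-column : ∀ n (M : Mat n) c → (∀ i → M i c ≈ 0#) → det n M ≈ 0#
  det-zero-column n M c h = trans (sym (det-transpose n M)) (det-zero-row n (transpose M) c h)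

  sumFin-last : ∀ m (f : Fin (suc m) → Carrier) → sumFin f ≈ sumFin (λ j → f (inject₁ j)) + f (fromℕ m)
  sumFin-last zero f = trans (+-identityʳ _) (sym (+-identityˡ _))
  sumFin-last (suc m) f = trans (+-congˡ (sumFin-last m (λ j → f (suc j)))) (sym (+-assoc _ _ _))

  altSign-inject₁ : ∀ {m} (j : Fin m) → altSign (inject₁ j) ≈ altSign j
  altSign-inject₁ zero = refl
  altSign-inject₁ (suc j) = -‿cong (altSign-inject₁ j)

  punchIn-inject₁ : ∀ {m} (j : Fin (suc m)) (k : Fin m) → punchIn (inject₁ j) (inject₁ k) ≡ inject₁ (punchIn j k)
  punchIn-inject₁ zero k = P.refl
  punchIn-inject₁ (suc j) zero = P.refl
  punchIn-inject₁ (suc j) (suc k) = P.cong suc (punchIn-inject₁ j k)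

  δF-last-punchIn : ∀ {m} (j k : Fin (suc m)) → δF (fromℕ (suc m)) (punchIn (inject₁ j) k) ≈ δF (fromℕ m) k
  δF-last-punchIn zero k = refl
  δF-last-punchIn {suc m} (suc j) zero = refl
  δF-last-punchIn {suc m} (suc j) (suc k) = δF-last-punchIn j k

  det-last-row-unit : ∀ n (M : Mat (suc n)) → (∀ k → M (fromℕ n) k ≈ δF (fromℕ n) k) →
                      det (suc n) M ≈ det n (λ i k → M (inject₁ i) (inject₁ k))
  det-last-row-unit zero M h =
    trans (det-suc zero M) (trans (+-identityʳ _) (trans (*-identityˡ _) (trans (*-identityʳ _) (h zero))))
  det-last-row-unit (suc n) M h = begin
    det (suc (suc n)) M
      ≈⟨ det-suc (suc n) M ⟩
    sumFin term
      ≈⟨ sumFin-last (suc n) term ⟩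
    sumFin (λ j → term (inject₁ j)) + term (fromℕ (suc n))
      ≈⟨ +-cong (sumFin-cong (λ j → *-cong (altSign-inject₁ j) (*-congˡ {M zero (inject₁ j)} (smaller-minor j))))
                (trans (*-congˡ (trans (*-congˡ last-minor) (zeroʳ _))) (zeroʳ _)) ⟩
    sumFin (λ j → altSign j * (TL zero j * det n (minor TL j))) + 0#
      ≈⟨ trans (+-identityʳ _) (sym (det-suc n TL)) ⟩
    det (suc n) TL ∎
    where
    term : Fin (suc (suc n)) → Carrier
    term j = altSign j * (M zero j * det (suc n) (minor M j))
    TL : Mat (suc n)
    TL i k = M (inject₁ i) (inject₁ k)
    smaller-minor : ∀ j → det (suc n) (minor M (inject₁ j)) ≈ det n (minor TL j)
    smaller-minor j = trans
      (det-last-row-unit n (minor M (inject₁ j)) (λ k → trans (h (punchIn (inject₁ j) k)) (δF-last-punchIn j k)))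
      (det-cong n (λ i k → reflexive (P.cong (M (suc (inject₁ i))) (punchIn-inject₁ j k))))
    -- deleting the last column leaves the last row zero
    last-minor : det (suc n) (minor M (fromℕ (suc n))) ≈ 0#
    last-minor = det-zero-row (suc n) (minor M (fromℕ (suc n))) (fromℕ n)
      (λ k → trans (h _) (δF-≢ _ _ (λ e → FinP.punchInᵢ≢i (fromℕ (suc n)) k (P.sym e))))

  BelowBand AboveBand : ∀ {n} → Mat n → Set ℓ
  BelowBand M = ∀ i j → 2 ℕ.+ toℕ j ℕ.≤ toℕ i → M i j ≈ 0#
  AboveBand M = ∀ i j → 2 ℕ.+ toℕ i ℕ.≤ toℕ j → M i j ≈ 0#

  -- deleting column 1 of a tridiagonal matrix leaves M₁₀ alone in the
  -- first column of the minor
  det-minor₁ : ∀ n (M : Mat (suc (suc n))) → BelowBand M → AboveBand M →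
               det (suc n) (minor M (suc zero)) ≈ M (suc zero) zero * det n (λ i j → M (suc (suc i)) (suc (suc j)))
  det-minor₁ zero M lo up = trans (det-suc zero (minor M (suc zero))) (trans (+-identityʳ _) (*-identityˡ _))
  det-minor₁ (suc n) M lo up = begin
    det (suc (suc n)) m₁
      ≈⟨ det-suc (suc n) m₁ ⟩
    1# * (M (suc zero) zero * D₂)
      + (- 1# * (m₁ zero (suc zero) * det (suc n) (minor m₁ (suc zero)))
         + sumFin (λ k → altSign (suc (suc k)) * (m₁ zero (suc (suc k)) * det (suc n) (minor m₁ (suc (suc k))))))
      ≈⟨ +-cong (*-identityˡ _) (+-cong (trans (*-congˡ (trans (*-congˡ zero-first-column) (zeroʳ _))) (zeroʳ _))
           (sumFin-zero _ (λ k → trans (*-congˡ (trans (*-congʳ (up (suc zero) (suc (suc (suc k))) (s≤s (s≤s (s≤s z≤n)))))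
                                                      (zeroˡ _))) (zeroʳ _)))) ⟩
    M (suc zero) zero * D₂ + (0# + 0#)
      ≈⟨ trans (+-congˡ (+-identityʳ _)) (+-identityʳ _) ⟩
    M (suc zero) zero * D₂ ∎
    where
    m₁ = minor M (suc zero)
    D₂ = det (suc n) (λ i j → M (suc (suc i)) (suc (suc j)))
    zero-first-column : det (suc n) (minor m₁ (suc zero)) ≈ 0#
    zero-first-column = det-zero-column (suc n) (minor m₁ (suc zero)) zero (λ i → lo (suc (suc i)) zero (s≤s (s≤s z≤n)))

  det-tridiagonal : ∀ n (M : Mat (suc (suc n))) → BelowBand M → AboveBand M →
    det (suc (suc n)) M ≈ M zero zero * det (suc n) (λ i j → M (suc i) (suc j))
                          - M zero (suc zero) * M (suc zero) zero * det n (λ i j → M (suc (suc i)) (suc (suc j)))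
  det-tridiagonal n M lo up = begin
    det (suc (suc n)) M
      ≈⟨ det-suc (suc n) M ⟩
    1# * (M zero zero * D₁) + (- 1# * (M zero (suc zero) * det (suc n) (minor M (suc zero)))
      + sumFin (λ j → altSign (suc (suc j)) * (M zero (suc (suc j)) * det (suc n) (minor M (suc (suc j))))))
      ≈⟨ +-congˡ (+-cong (*-congˡ (*-congˡ (det-minor₁ n M lo up)))
           (sumFin-zero _ (λ j → trans (*-congˡ (trans (*-congʳ (up zero (suc (suc j)) (s≤s (s≤s z≤n)))) (zeroˡ _))) (zeroʳ _)))) ⟩
    1# * (M zero zero * D₁) + (- 1# * (M zero (suc zero) * (M (suc zero) zero * D₂)) + 0#)
      ≈⟨ solve 5 (λ a d₁ b e d₂ → :1 :* (a :* d₁) :+ ((:- :1) :* (b :* (e :* d₂)) :+ :0) := a :* d₁ :- b :* e :* d₂)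
                 refl (M zero zero) D₁ (M zero (suc zero)) (M (suc zero) zero) D₂ ⟩
    M zero zero * D₁ - M zero (suc zero) * M (suc zero) zero * D₂ ∎
    where
    D₁ = det (suc n) (λ i j → M (suc i) (suc j))
    D₂ = det n (λ i j → M (suc (suc i)) (suc (suc j)))

-- Closed forms.  σ L = Σ_{j ≤ L} sʲ b^(L-j) solves the recurrence of the
-- constant tridiagonal determinants; the product of the Λ's is the
-- prefactor 2^(n-1) b^C(n,2) s^C(n,2); and the two expressions F₁, F₂ for
-- the last factor of dd₂ satisfy the same first-order recurrence
-- X (n+1) = (s^(n+1) + b^(n+1))² + k X n.
module ClosedForms {c ℓ} (R : CommutativeRing c ℓ) (a b : CommutativeRing.Carrier R) where

  open import Data.Nat using (zero; suc)
  import Data.Nat.Properties as ℕP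
  open import Data.Nat.Combinatorics using (_C_; nC1≡n; nCk+nC[k+1]≡[n+1]C[k+1])
  open import Relation.Binary.PropositionalEquality as P using (_≡_)
  open CommutativeRing R hiding (zero)
  open import Relation.Binary.Reasoning.Setoid setoid
  open IntegerRingSolver R using (solve; _:=_; _:+_; _:*_; _:-_; :0; :1)
  open FiniteSums R
  open Series R using (pow; fromℕ; ∑)
  open HankelFactorisation R a b

  pow-+ : ∀ y m n → pow y (m ℕ.+ n) ≈ pow y m * pow y n
  pow-+ y zero n = sym (*-identityˡ _)
  pow-+ y (suc m) n = trans (*-congˡ (pow-+ y m n)) (sym (*-assoc _ _ _))

  pow-* : ∀ y z n → pow (y * z) n ≈ pow y n * pow z n
  pow-* y z zero = sym (*-identityˡ _)
  pow-* y z (suc n) = trans (*-congˡ (pow-* y z n))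
    (solve 4 (λ y z p q → (y :* z) :* (p :* q) := (y :* p) :* (z :* q)) refl y z _ _)

  pow-double : ∀ y n → pow y (2 ℕ.* n) ≈ pow y n * pow y n
  pow-double y n = trans (pow-+ y n (n ℕ.+ 0)) (*-congˡ (reflexive (P.cong (pow y) (ℕP.+-identityʳ n))))

  σ : ℕ → Carrier
  σ L = sum (suc L) (λ j → pow s j * pow b (L ℕ.∸ j))

  -- splitting off the term j = 0, resp. j = L + 1
  σ-first : ∀ L → σ (suc L) ≈ pow b (suc L) + s * σ L
  σ-first L = +-cong (*-identityˡ _)
    (trans (sum-cong (suc L) (λ j → *-assoc s (pow s j) (pow b (L ℕ.∸ j)))) (sum-*ˡ (suc L) s (λ j → pow s j * pow b (L ℕ.∸ j))))

  σ-last : ∀ L → σ (suc L) ≈ pow s (suc L) + b * σ L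
  σ-last L = begin
    σ (suc L)
      ≈⟨ sum-last (suc L) (λ j → pow s j * pow b (suc L ℕ.∸ j)) ⟩
    sum (suc L) (λ j → pow s j * pow b (suc L ℕ.∸ j)) + pow s (suc L) * pow b (suc L ℕ.∸ suc L)
      ≈⟨ +-cong (sum-cong< (suc L) (λ j j< → *-congˡ {pow s j} (reflexive (P.cong (pow b) (ℕP.+-∸-assoc 1 (ℕP.≤-pred j<))))))
                (trans (*-congˡ (reflexive (P.cong (pow b) (ℕP.n∸n≡0 L)))) (*-identityʳ _)) ⟩
    sum (suc L) (λ j → pow s j * (b * pow b (L ℕ.∸ j))) + pow s (suc L)
      ≈⟨ +-congʳ (trans (sum-cong (suc L) (λ j → solve 3 (λ p b q → p :* (b :* q) := b :* (p :* q)) refl (pow s j) b (pow b (L ℕ.∸ j))))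
                        (sum-*ˡ (suc L) b (λ j → pow s j * pow b (L ℕ.∸ j)))) ⟩
    b * σ L + pow s (suc L)
      ≈⟨ +-comm _ _ ⟩
    pow s (suc L) + b * σ L ∎

  σ-two-steps : ∀ L → σ (suc (suc L)) ≈ pow s (suc (suc L)) + pow b (suc (suc L)) + k * σ L
  σ-two-steps L = begin
    σ (suc (suc L))                                        ≈⟨ σ-last (suc L) ⟩
    pow s (suc (suc L)) + b * σ (suc L)                    ≈⟨ +-congˡ (*-congˡ (σ-first L)) ⟩
    pow s (suc (suc L)) + b * (pow b (suc L) + s * σ L)
      ≈⟨ solve 5 (λ S b B s σ → S :+ b :* (B :+ s :* σ) := S :+ b :* B :+ b :* s :* σ)
                refl (pow s (suc (suc L))) b (pow b (suc L)) s (σ L) ⟩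
    pow s (suc (suc L)) + pow b (suc (suc L)) + k * σ L   ∎

  σ-recurrence : ∀ L → x * σ (suc L) - k * σ L ≈ σ (suc (suc L))
  σ-recurrence L = begin
    x * σ (suc L) - k * σ L
      ≈⟨ solve 4 (λ s b σ₁ σ₀ → (s :+ b) :* σ₁ :- b :* s :* σ₀ := s :* σ₁ :+ b :* (σ₁ :- s :* σ₀)) refl s b (σ (suc L)) (σ L) ⟩
    s * σ (suc L) + b * (σ (suc L) - s * σ L)
      ≈⟨ +-congˡ (*-congˡ (+-congʳ (σ-first L))) ⟩
    s * σ (suc L) + b * (pow b (suc L) + s * σ L - s * σ L)
      ≈⟨ solve 5 (λ s b B X σ₁ → s :* σ₁ :+ b :* (B :+ X :- X) := b :* B :+ s :* σ₁) refl s b (pow b (suc L)) (s * σ L) (σ (suc L)) ⟩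
    pow b (suc (suc L)) + s * σ (suc L)
      ≈⟨ sym (σ-first (suc L)) ⟩
    σ (suc (suc L)) ∎

  Λ-closed : ∀ m → Λ (suc m) ≈ (1# + 1#) * pow k (suc m)
  Λ-closed zero = solve 1 (λ k → (k :+ k) :* :1 := (:1 :+ :1) :* (k :* :1)) refl k
  Λ-closed (suc m) = trans (*-congˡ (Λ-closed m))
    (solve 2 (λ k p → k :* ((:1 :+ :1) :* p) := (:1 :+ :1) :* (k :* p)) refl k (pow k (suc m)))

  -- the common prefactor 2^(n-1) b^C(n,2) s^C(n,2) of the statement
  prefactor : ℕ → Carrier
  prefactor n = pow (1# + 1#) (n ℕ.∸ 1) * pow b (n C 2) * pow s (n C 2)

  choose2-suc : ∀ n → suc (suc n) C 2 ≡ suc n ℕ.+ suc n C 2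
  choose2-suc n = P.trans (P.sym (nCk+nC[k+1]≡[n+1]C[k+1] (suc n) 1)) (P.cong (ℕ._+ suc n C 2) (nC1≡n (suc n)))

  prod-Λ : ∀ n → prod (suc n) Λ ≈ prefactor (suc n)
  prod-Λ zero = solve 0 (:1 :* :1 := :1 :* :1 :* :1) refl
  prod-Λ (suc n) = begin
    prod (suc (suc n)) Λ
      ≈⟨ prod-last (suc n) Λ ⟩
    prod (suc n) Λ * Λ (suc n)
      ≈⟨ *-cong (prod-Λ n) (Λ-closed n) ⟩
    prefactor (suc n) * ((1# + 1#) * pow k (suc n))
      ≈⟨ *-congˡ (*-congˡ (pow-* b s (suc n))) ⟩
    pow (1# + 1#) n * pow b Cn * pow s Cn * ((1# + 1#) * (pow b (suc n) * pow s (suc n)))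
      ≈⟨ solve 5 (λ t pb ps B S → t :* pb :* ps :* ((:1 :+ :1) :* (B :* S)) := (:1 :+ :1) :* t :* (B :* pb) :* (S :* ps))
                 refl (pow (1# + 1#) n) (pow b Cn) (pow s Cn) (pow b (suc n)) (pow s (suc n)) ⟩
    pow (1# + 1#) (suc n) * (pow b (suc n) * pow b Cn) * (pow s (suc n) * pow s Cn)
      ≈⟨ sym (*-cong (*-congˡ (pow-+ b (suc n) Cn)) (pow-+ s (suc n) Cn)) ⟩
    pow (1# + 1#) (suc n) * pow b (suc n ℕ.+ Cn) * pow s (suc n ℕ.+ Cn)
      ≡⟨ P.cong (λ t → pow (1# + 1#) (suc n) * pow b t * pow s t) (P.sym (choose2-suc n)) ⟩
    prefactor (suc (suc n)) ∎
    where Cn = suc n C 2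

  prefactor-step : ∀ m → prefactor (suc m) * Λ (suc m) ≈ prefactor (suc (suc m))
  prefactor-step m = trans (*-congʳ (sym (prod-Λ m))) (trans (sym (prod-last (suc m) Λ)) (prod-Λ (suc m)))

  u : ℕ → Carrier
  u j = pow (pow s j + pow b j) 2

  -- the two forms of the last factor of dd₂ in the statement
  F₁ : ℕ → Carrier
  F₁ n = fromℕ 2 * pow b n * pow s n + ∑ 1 n (λ j → u j * pow b (n ℕ.∸ j) * pow s (n ℕ.∸ j))

  F₂ : ℕ → Carrier
  F₂ n = ∑ 0 (2 ℕ.* n) (λ j → pow s j * pow b (2 ℕ.* n ℕ.∸ j)) + fromℕ (2 ℕ.* n ℕ.+ 1) * pow b n * pow s n

  -- the sum in F₁ with the index shifted to start at 0
  Σ₁ : ℕ → Carrier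
  Σ₁ n = sum n (λ t → u (suc t) * pow b (n ℕ.∸ suc t) * pow s (n ℕ.∸ suc t))

  Σ₁-recurrence : ∀ n → Σ₁ (suc n) ≈ k * Σ₁ n + u (suc n)
  Σ₁-recurrence n = begin
    Σ₁ (suc n)
      ≈⟨ sum-last n (λ t → u (suc t) * pow b (n ℕ.∸ t) * pow s (n ℕ.∸ t)) ⟩
    sum n (λ t → u (suc t) * pow b (n ℕ.∸ t) * pow s (n ℕ.∸ t)) + u (suc n) * pow b (n ℕ.∸ n) * pow s (n ℕ.∸ n)
      ≈⟨ +-cong (sum-cong< n (λ t t<n → trans (reflexive (P.cong (λ e → u (suc t) * pow b e * pow s e) (ℕP.+-∸-assoc 1 t<n)))
                   (solve 5 (λ U b s Y Z → U :* (b :* Y) :* (s :* Z) := b :* s :* (U :* Y :* Z))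
                          refl (u (suc t)) b s (pow b (n ℕ.∸ suc t)) (pow s (n ℕ.∸ suc t)))))
                (trans (reflexive (P.cong (λ e → u (suc n) * pow b e * pow s e) (ℕP.n∸n≡0 n))) (trans (*-identityʳ _) (*-identityʳ _))) ⟩
    sum n (λ t → k * (u (suc t) * pow b (n ℕ.∸ suc t) * pow s (n ℕ.∸ suc t))) + u (suc n)
      ≈⟨ +-congʳ (sum-*ˡ n k _) ⟩
    k * Σ₁ n + u (suc n) ∎

  F₁-recurrence : ∀ n → F₁ (suc n) ≈ u (suc n) + k * F₁ n
  F₁-recurrence n = begin
    F₁ (suc n)
      ≈⟨ +-congˡ (sumRange≈sum 1 (suc n) _) ⟩
    fromℕ 2 * (b * pow b n) * (s * pow s n) + Σ₁ (suc n)
      ≈⟨ +-congˡ (Σ₁-recurrence n) ⟩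
    fromℕ 2 * (b * pow b n) * (s * pow s n) + (k * Σ₁ n + u (suc n))
      ≈⟨ solve 7 (λ t b pb s ps X U → t :* (b :* pb) :* (s :* ps) :+ (b :* s :* X :+ U) := U :+ b :* s :* (t :* pb :* ps :+ X))
                 refl (fromℕ 2) b (pow b n) s (pow s n) (Σ₁ n) (u (suc n)) ⟩
    u (suc n) + k * (fromℕ 2 * pow b n * pow s n + Σ₁ n)
      ≈⟨ +-congˡ (*-congˡ (sym (+-congˡ (sumRange≈sum 1 n _)))) ⟩
    u (suc n) + k * F₁ n ∎

  F₂-recurrence : ∀ n → F₂ (suc n) ≈ u (suc n) + k * F₂ n
  F₂-recurrence n = begin
    F₂ (suc n)
      ≈⟨ +-congʳ (sumRange≈sum 0 (suc (2 ℕ.* suc n)) _) ⟩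
    σ (2 ℕ.* suc n) + fromℕ (2 ℕ.* suc n ℕ.+ 1) * pow b (suc n) * pow s (suc n)
      ≡⟨ P.cong (λ t → σ t + fromℕ (t ℕ.+ 1) * pow b (suc n) * pow s (suc n)) (ℕP.*-suc 2 n) ⟩
    σ (suc (suc (2 ℕ.* n))) + (1# + (1# + F)) * (b * pow b n) * (s * pow s n)
      ≈⟨ +-congʳ (trans (σ-two-steps (2 ℕ.* n)) (+-congʳ (+-cong (*-congˡ (*-congˡ (pow-double s n)))
                                                                  (*-congˡ (*-congˡ (pow-double b n)))))) ⟩
    s * (s * (pow s n * pow s n)) + b * (b * (pow b n * pow b n)) + k * σ (2 ℕ.* n)
      + (1# + (1# + F)) * (b * pow b n) * (s * pow s n)
      ≈⟨ solve 6 (λ s b ps pb σ F → s :* (s :* (ps :* ps)) :+ b :* (b :* (pb :* pb)) :+ b :* s :* σ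
                                    :+ (:1 :+ (:1 :+ F)) :* (b :* pb) :* (s :* ps)
                  := (s :* ps :+ b :* pb) :* ((s :* ps :+ b :* pb) :* :1) :+ b :* s :* (σ :+ F :* pb :* ps))
                 refl s b (pow s n) (pow b n) (σ (2 ℕ.* n)) F ⟩
    u (suc n) + k * (σ (2 ℕ.* n) + F * pow b n * pow s n)
      ≈⟨ +-congˡ (*-congˡ (+-congʳ (sym (sumRange≈sum 0 (suc (2 ℕ.* n)) _)))) ⟩
    u (suc n) + k * F₂ n ∎
    where F = fromℕ (2 ℕ.* n ℕ.+ 1)

  F₁≈F₂ : ∀ n → F₁ n ≈ F₂ n
  F₁≈F₂ zero = solve 0 ((:1 :+ (:1 :+ :0)) :* :1 :* :1 :+ :0 := (:1 :* :1 :+ :0) :+ (:1 :+ :0) :* :1 :* :1) refl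
  F₁≈F₂ (suc n) = trans (F₁-recurrence n) (trans (+-congˡ (*-congˡ (F₁≈F₂ n))) (sym (F₂-recurrence n)))

-- With the n × n matrices
--   L = (μ i r),  D = diag (Λ r),  T = (T r r'),
-- the factorisations of HankelFactorisation read H₀ = L D Lᵀ,
-- H₁ = L (T D) Lᵀ and H₂ = L K Lᵀ with K r r' = Σ_{m ≤ n} T r m Λ m T r' m.
-- Since det L = 1 this gives det H₀ = Π Λ, det H₁ = det T · Π Λ, and K is
-- T D Tᵀ plus Λ n in the last diagonal entry, whence a recurrence for det K.
module HankelDeterminants {c ℓ} (R : CommutativeRing c ℓ) (a b : CommutativeRing.Carrier R) where

  open import Data.Nat using (zero; suc; s≤s)
  import Data.Nat.Properties as ℕP
  open import Data.Fin as Fin using (Fin; zero; suc; toℕ; inject₁; fromℕ)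
  import Data.Fin.Properties as FinP
  open import Relation.Binary.PropositionalEquality as P using (_≡_)
  open import Relation.Nullary using (Dec; yes; no)
  open CommutativeRing R hiding (zero)
  open import Relation.Binary.Reasoning.Setoid setoid
  open IntegerRingSolver R using (solve; _:=_; _:+_; _:*_; _:-_; :0; :1)
  open FiniteSums R
  open Determinants R
  open DeterminantLaws R using (_⊙_; transpose; det-mul; det-transpose)
  open SpecialDeterminants R
  open Series R using (det; pow; dd)
  open HankelFactorisation R a b
  open ClosedForms R a b

  Lmat Dmat Tmat Kmat : ∀ n → Mat n
  Lmat n i r = μ (toℕ i) (toℕ r)
  Dmat n r r' = δF r r' * Λ (toℕ r')
  Tmat n r r' = T (toℕ r) (toℕ r')
  Kmat n r r' = T²-kernel n (toℕ r) (toℕ r')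

  prodFin-one : ∀ {n} (f : Fin n → Carrier) → (∀ i → f i ≈ 1#) → prodFin f ≈ 1#
  prodFin-one {zero} f h = refl
  prodFin-one {suc n} f h = trans (*-cong (h zero) (prodFin-one (λ i → f (suc i)) (λ i → h (suc i)))) (*-identityˡ _)

  det-L : ∀ n → det n (Lmat n) ≈ 1#
  det-L n = trans (det-lowerTriangular n (Lmat n) (λ i j lt → μ-unreachable (toℕ i) (toℕ j) lt))
                  (prodFin-one {n} (λ i → Lmat n i i) (λ i → μ-diagonal (toℕ i)))

  det-D : ∀ n → det n (Dmat n) ≈ prod n Λ
  det-D n = begin
    det n (Dmat n)
      ≈⟨ det-lowerTriangular n (Dmat n) (λ i j lt → trans (*-congʳ (δF-≢ i j (λ e → ℕP.<⇒≢ lt (P.cong toℕ e)))) (zeroˡ _)) ⟩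
    prodFin (λ i → Dmat n i i)
      ≈⟨ prodFin-cong {n} (λ i → trans (*-congʳ (δF-refl i)) (*-identityˡ _)) ⟩
    prodFin {n} (λ i → Λ (toℕ i))
      ≈⟨ prodFin-toℕ n Λ ⟩
    prod n Λ ∎

  sandwich-entry : ∀ n (X : Mat n) (Xf : ℕ → ℕ → Carrier) → (∀ r r' → X r r' ≈ Xf (toℕ r) (toℕ r')) →
                   ∀ i j → (Lmat n ⊙ (X ⊙ transpose (Lmat n))) i j ≈ sandwich n Xf (toℕ i) (toℕ j)
  sandwich-entry n X Xf h i j = trans
    (sumFin-cong (λ r → *-congˡ (trans (sumFin-cong (λ r' → *-congʳ (h r r')))
                                       (sumFin-toℕ n (λ r' → Xf (toℕ r) r' * μ (toℕ j) r')))))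
    (sumFin-toℕ n (λ r → μ (toℕ i) r * sum n (λ r' → Xf r r' * μ (toℕ j) r')))

  det-sandwich : ∀ n (X : Mat n) → det n (Lmat n ⊙ (X ⊙ transpose (Lmat n))) ≈ det n X
  det-sandwich n X = begin
    det n (Lmat n ⊙ (X ⊙ transpose (Lmat n)))
      ≈⟨ det-mul n (Lmat n) _ ⟩
    det n (Lmat n) * det n (X ⊙ transpose (Lmat n))
      ≈⟨ *-cong (det-L n) (det-mul n X (transpose (Lmat n))) ⟩
    1# * (det n X * det n (transpose (Lmat n)))
      ≈⟨ trans (*-identityˡ _) (trans (*-congˡ (trans (det-transpose n (Lmat n)) (det-L n))) (*-identityʳ _)) ⟩
    det n X ∎

  band : (ℕ → Carrier) → ℕ → ℕ → Carrier
  band w i j = δ (suc i) j + x * δ i j + w i * δ i (suc j)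

  band-below : ∀ w i j → 2 ℕ.+ j ℕ.≤ i → band w i j ≈ 0#
  band-below w i j le = trans (+-cong (+-cong
      (δ-≢ (suc i) j (λ e → ℕP.<⇒≢ (s≤s (ℕP.≤-trans (ℕP.n≤1+n j) (ℕP.≤-trans (ℕP.n≤1+n (suc j)) le))) (P.sym e)))
      (trans (*-congˡ (δ-≢ i j (λ e → ℕP.<⇒≢ (ℕP.≤-trans (ℕP.n≤1+n (suc j)) le) (P.sym e)))) (zeroʳ _)))
      (trans (*-congˡ (δ-≢ i (suc j) (λ e → ℕP.<⇒≢ le (P.sym e)))) (zeroʳ _)))
    (solve 0 (:0 :+ :0 :+ :0 := :0) refl)

  band-above : ∀ w i j → 2 ℕ.+ i ℕ.≤ j → band w i j ≈ 0#
  band-above w i j le = trans (+-cong (+-cong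
      (δ-≢ (suc i) j (λ e → ℕP.<⇒≢ le e))
      (trans (*-congˡ (δ-≢ i j (λ e → ℕP.<⇒≢ (ℕP.≤-trans (ℕP.n≤1+n (suc i)) le) e))) (zeroʳ _)))
      (trans (*-congˡ (δ-≢ i (suc j) (λ e → ℕP.<⇒≢ (ℕP.≤-trans (ℕP.n≤1+n (suc i)) (ℕP.≤-trans le (ℕP.n≤1+n j))) e))) (zeroʳ _)))
    (solve 0 (:0 :+ :0 :+ :0 := :0) refl)

  bandMat : (ℕ → Carrier) → ∀ L → Mat L
  bandMat w L i j = band w (toℕ i) (toℕ j)

  det-constant-band : ∀ L → det L (bandMat (λ _ → k) L) ≈ σ L
  det-constant-band zero = sym (trans (+-identityʳ _) (*-identityˡ _))
  det-constant-band (suc zero) = begin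
    det 1 (bandMat (λ _ → k) 1)
      ≈⟨ trans (det-suc 0 (bandMat (λ _ → k) 1)) (trans (+-identityʳ _) (trans (*-identityˡ _) (*-identityʳ _))) ⟩
    0# + x * 1# + k * 0#
      ≈⟨ solve 3 (λ s b k → :0 :+ (s :+ b) :* :1 :+ k :* :0 := :1 :* (b :* :1) :+ ((s :* :1) :* :1 :+ :0)) refl s b k ⟩
    σ 1 ∎
  det-constant-band (suc (suc L)) = begin
    det (suc (suc L)) (bandMat (λ _ → k) (suc (suc L)))
      ≈⟨ det-tridiagonal L _ (λ i j → band-below (λ _ → k) (toℕ i) (toℕ j)) (λ i j → band-above (λ _ → k) (toℕ i) (toℕ j)) ⟩
    (0# + x * 1# + k * 0#) * det (suc L) (bandMat (λ _ → k) (suc L))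
      - (1# + x * 0# + k * 0#) * (0# + x * 0# + k * 1#) * det L (bandMat (λ _ → k) L)
      ≈⟨ solve 4 (λ x k E₁ E₀ → (:0 :+ x :* :1 :+ k :* :0) :* E₁ :- (:1 :+ x :* :0 :+ k :* :0) :* (:0 :+ x :* :0 :+ k :* :1) :* E₀
                               := x :* E₁ :- k :* E₀) refl x k _ _ ⟩
    x * det (suc L) (bandMat (λ _ → k) (suc L)) - k * det L (bandMat (λ _ → k) L)
      ≈⟨ +-cong (*-congˡ (det-constant-band (suc L))) (-‿cong (*-congˡ (det-constant-band L))) ⟩
    x * σ (suc L) - k * σ L
      ≈⟨ σ-recurrence L ⟩
    σ (suc (suc L)) ∎

  T-tail : ∀ n (i j : Fin n) → Tmat (suc n) (suc i) (suc j) ≈ bandMat (λ _ → k) n i j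
  T-tail n i j = +-congˡ (tail-weight (toℕ i) (toℕ j))
    where
    tail-weight : ∀ p q → down (suc p) * δ p (suc q) ≈ k * δ p (suc q)
    tail-weight zero q = trans (zeroʳ _) (sym (zeroʳ _))
    tail-weight (suc p) q = refl

  det-T : ∀ n → det (suc n) (Tmat (suc n)) ≈ pow s (suc n) + pow b (suc n)
  det-T zero = begin
    det 1 (Tmat 1)
      ≈⟨ trans (det-suc 0 (Tmat 1)) (trans (+-identityʳ _) (trans (*-identityˡ _) (*-identityʳ _))) ⟩
    0# + x * 1# + 0# * 0#
      ≈⟨ solve 2 (λ s b → :0 :+ (s :+ b) :* :1 :+ :0 :* :0 := s :* :1 :+ b :* :1) refl s b ⟩
    pow s 1 + pow b 1 ∎
  det-T (suc n) = begin
    det (suc (suc n)) (Tmat (suc (suc n)))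
      ≈⟨ det-tridiagonal n (Tmat (suc (suc n))) (λ i j → band-below down (toℕ i) (toℕ j)) (λ i j → band-above down (toℕ i) (toℕ j)) ⟩
    (0# + x * 1# + 0# * 0#) * det (suc n) (λ i j → Tmat (suc (suc n)) (suc i) (suc j))
      - (1# + x * 0# + 0# * 0#) * (0# + x * 0# + (k + k) * 1#) * det n (λ i j → Tmat (suc (suc n)) (suc (suc i)) (suc (suc j)))
      ≈⟨ +-cong (*-congˡ (trans (det-cong (suc n) (T-tail (suc n))) (det-constant-band (suc n))))
                (-‿cong (*-congˡ (det-constant-band n))) ⟩
    (0# + x * 1# + 0# * 0#) * σ (suc n) - (1# + x * 0# + 0# * 0#) * (0# + x * 0# + (k + k) * 1#) * σ n
      ≈⟨ solve 4 (λ x k S₁ S₀ → (:0 :+ x :* :1 :+ :0 :* :0) :* S₁ :- (:1 :+ x :* :0 :+ :0 :* :0) :* (:0 :+ x :* :0 :+ (k :+ k) :* :1) :* S₀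
                                := (x :* S₁ :- k :* S₀) :- k :* S₀) refl x k (σ (suc n)) (σ n) ⟩
    (x * σ (suc n) - k * σ n) - k * σ n
      ≈⟨ +-congʳ (trans (σ-recurrence n) (σ-two-steps n)) ⟩
    (pow s (suc (suc n)) + pow b (suc (suc n)) + k * σ n) - k * σ n
      ≈⟨ solve 3 (λ A B C → A :+ B :+ C :- C := A :+ B) refl (pow s (suc (suc n))) (pow b (suc (suc n))) (k * σ n) ⟩
    pow s (suc (suc n)) + pow b (suc (suc n)) ∎

  Amat : ∀ n → Mat n
  Amat n = Tmat n ⊙ (Dmat n ⊙ transpose (Tmat n))

  A-entry : ∀ n r r' → Amat n r r' ≈ sum n (λ m → T (toℕ r) m * Λ m * T (toℕ r') m)
  A-entry n r r' = begin
    Amat n r r'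
      ≈⟨ sumFin-cong {n} (λ q → *-congˡ {T (toℕ r) (toℕ q)} (diagonal q)) ⟩
    sumFin {n} (λ q → T (toℕ r) (toℕ q) * (Λ (toℕ q) * T (toℕ r') (toℕ q)))
      ≈⟨ sumFin-toℕ n (λ m → T (toℕ r) m * (Λ m * T (toℕ r') m)) ⟩
    sum n (λ m → T (toℕ r) m * (Λ m * T (toℕ r') m))
      ≈⟨ sum-cong n (λ m → sym (*-assoc (T (toℕ r) m) (Λ m) (T (toℕ r') m))) ⟩
    sum n (λ m → T (toℕ r) m * Λ m * T (toℕ r') m) ∎
    where
    diagonal : ∀ q → sumFin (λ q' → δF q q' * Λ (toℕ q') * T (toℕ r') (toℕ q')) ≈ Λ (toℕ q) * T (toℕ r') (toℕ q)
    diagonal q = trans (sumFin-cong {n} (λ q' → *-assoc (δF q q') (Λ (toℕ q')) (T (toℕ r') (toℕ q'))))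
                       (sumFin-δ q (λ q' → Λ (toℕ q') * T (toℕ r') (toℕ q')))

  det-A : ∀ n → det n (Amat n) ≈ det n (Tmat n) * (prod n Λ * det n (Tmat n))
  det-A n = trans (det-mul n (Tmat n) _)
    (*-congˡ (trans (det-mul n (Dmat n) (transpose (Tmat n))) (*-cong (det-D n) (det-transpose n (Tmat n)))))

  -- from heights r ≤ n' the only step to height n' + 1 goes up from n'
  T-to-top : ∀ n' r → r ℕ.≤ n' → T r (suc n') ≈ δ r n'
  T-to-top n' r r≤ = trans
    (+-congˡ (trans (*-congˡ (δ-≢ r (suc (suc n')) (λ e → ℕP.<⇒≢ (s≤s (ℕP.≤-trans r≤ (ℕP.n≤1+n n'))) e))) (zeroʳ _)))
    (trans (+-congʳ (+-congˡ (trans (*-congˡ (δ-≢ r (suc n') (λ e → ℕP.<⇒≢ (s≤s r≤) e))) (zeroʳ _))))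
           (trans (+-identityʳ _) (+-identityʳ _)))

  -- K (n'+1) is A (n'+1) with Λ (n'+1) added in the last diagonal entry
  K-as-update : ∀ n' r r' → Kmat (suc n') r r'
    ≈ update (Amat (suc n')) (fromℕ n') (λ j → 1# * Amat (suc n') (fromℕ n') j + Λ (suc n') * δF (fromℕ n') j) r r'
  K-as-update n' r r' = begin
    T²-kernel (suc n') (toℕ r) (toℕ r')
      ≈⟨ sum-last (suc n') (λ m → T (toℕ r) m * Λ m * T (toℕ r') m) ⟩
    sum (suc n') (λ m → T (toℕ r) m * Λ m * T (toℕ r') m) + T (toℕ r) (suc n') * Λ (suc n') * T (toℕ r') (suc n')
      ≈⟨ +-cong (sym (A-entry (suc n') r r')) (*-cong (*-congʳ (T-to-top n' (toℕ r) (ℕP.≤-pred (FinP.toℕ<n r))))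
                                                    (T-to-top n' (toℕ r') (ℕP.≤-pred (FinP.toℕ<n r')))) ⟩
    Am r r' + δ (toℕ r) n' * Λ (suc n') * δ (toℕ r') n'
      ≈⟨ last-row? (r Fin.≟ fromℕ n') ⟩
    update Am (fromℕ n') newRow r r' ∎
    where
    Am = Amat (suc n')
    newRow = λ j → 1# * Am (fromℕ n') j + Λ (suc n') * δF (fromℕ n') j
    last-row? : Dec (r ≡ fromℕ n') → Am r r' + δ (toℕ r) n' * Λ (suc n') * δ (toℕ r') n' ≈ update Am (fromℕ n') newRow r r'
    last-row? (yes P.refl) = begin
      Am (fromℕ n') r' + δ (toℕ (fromℕ n')) n' * Λ (suc n') * δ (toℕ r') n'
        ≈⟨ +-congˡ (*-congʳ (*-congʳ (trans (reflexive (P.cong (λ t → δ t n') (FinP.toℕ-fromℕ n'))) (δ-refl n')))) ⟩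
      Am (fromℕ n') r' + 1# * Λ (suc n') * δ (toℕ r') n'
        ≈⟨ +-cong (sym (*-identityˡ _)) (trans (*-congʳ (*-identityˡ _)) (*-congˡ (trans (δ-sym (toℕ r') n')
             (trans (reflexive (P.cong (λ t → δ t (toℕ r')) (P.sym (FinP.toℕ-fromℕ n')))) (sym (δF-toℕ (fromℕ n') r')))))) ⟩
      1# * Am (fromℕ n') r' + Λ (suc n') * δF (fromℕ n') r'
        ≈⟨ sym (reflexive (P.cong (λ row → row r') (update-same Am (fromℕ n') newRow))) ⟩
      update Am (fromℕ n') newRow (fromℕ n') r' ∎
    last-row? (no ne) = trans
      (+-congˡ (trans (*-congʳ (trans (*-congʳ (δ-≢ (toℕ r) n'
        (λ e → ne (FinP.toℕ-injective (P.trans e (P.sym (FinP.toℕ-fromℕ n'))))))) (zeroˡ _))) (zeroˡ _)))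
      (trans (+-identityʳ _) (sym (reflexive (P.cong (λ row → row r') (update-other Am (fromℕ n') newRow r ne)))))

  -- linearity in the last row: det K (n'+1) = det A (n'+1) + Λ (n'+1) det K n'
  det-K-recurrence : ∀ n' → det (suc n') (Kmat (suc n')) ≈ det (suc n') (Amat (suc n')) + Λ (suc n') * det n' (Kmat n')
  det-K-recurrence n' = begin
    det (suc n') (Kmat (suc n'))
      ≈⟨ det-cong (suc n') (K-as-update n') ⟩
    det (suc n') (update Am last (λ j → 1# * Am last j + Λ (suc n') * δF last j))
      ≈⟨ det-rowLinear (suc n') Am last 1# (Λ (suc n')) (Am last) (δF last) ⟩
    1# * det (suc n') (update Am last (Am last)) + Λ (suc n') * det (suc n') (update Am last (δF last))
      ≈⟨ +-cong (trans (*-identityˡ _) (det-cong (suc n') (rows-≡ (λ i → update-self Am last i))))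
                (*-congˡ (trans (det-last-row-unit n' (update Am last (δF last))
                                   (λ j → reflexive (P.cong (λ row → row j) (update-same Am last (δF last)))))
                                (det-cong n' top-left))) ⟩
    det (suc n') Am + Λ (suc n') * det n' (Kmat n') ∎
    where
    Am = Amat (suc n')
    last = fromℕ n'
    top-left : ∀ i j → update Am last (δF last) (inject₁ i) (inject₁ j) ≈ Kmat n' i j
    top-left i j = trans
      (reflexive (P.cong (λ row → row (inject₁ j)) (update-other Am last (δF last) (inject₁ i) (λ e → FinP.fromℕ≢inject₁ (P.sym e)))))
      (trans (A-entry (suc n') (inject₁ i) (inject₁ j))
             (reflexive (P.cong₂ (λ p q → sum (suc n') (λ m → T p m * Λ m * T q m)) (FinP.toℕ-inject₁ i) (FinP.toℕ-inject₁ j))))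

  det-K : ∀ n' → det (suc n') (Kmat (suc n')) ≈ prefactor (suc n') * F₁ (suc n')
  det-K zero = begin
    det 1 (Kmat 1)
      ≈⟨ det-K-recurrence zero ⟩
    det 1 (Amat 1) + Λ 1 * 1#
      ≈⟨ +-congʳ (trans (det-A 1) (*-cong (det-T 0) (*-congˡ (det-T 0)))) ⟩
    X * (prod 1 Λ * X) + Λ 1 * 1#
      ≈⟨ solve 2 (λ X k → X :* ((:1 :* :1) :* X) :+ (k :+ k) :* :1 :* :1
                          := :1 :* :1 :* :1 :* (X :* (X :* :1) :+ k :* ((:1 :+ (:1 :+ :0)) :* :1 :* :1 :+ :0))) refl X k ⟩
    prefactor 1 * (u 1 + k * F₁ 0)
      ≈⟨ *-congˡ (sym (F₁-recurrence 0)) ⟩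
    prefactor 1 * F₁ 1 ∎
    where X = pow s 1 + pow b 1
  det-K (suc m) = begin
    det (suc (suc m)) (Kmat (suc (suc m)))
      ≈⟨ det-K-recurrence (suc m) ⟩
    det (suc (suc m)) (Amat (suc (suc m))) + Λ (suc (suc m)) * det (suc m) (Kmat (suc m))
      ≈⟨ +-cong (trans (det-A (suc (suc m))) (*-cong (det-T (suc m)) (*-cong (prod-Λ (suc m)) (det-T (suc m)))))
                (*-congˡ (det-K m)) ⟩
    X * (P₂ * X) + k * Λ (suc m) * (P₁ * F₁ (suc m))
      ≈⟨ solve 6 (λ X D k L D' F → X :* (D :* X) :+ k :* L :* (D' :* F) := D :* (X :* (X :* :1)) :+ k :* (D' :* L) :* F)
                 refl X P₂ k (Λ (suc m)) P₁ (F₁ (suc m)) ⟩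
    P₂ * u (suc (suc m)) + k * (P₁ * Λ (suc m)) * F₁ (suc m)
      ≈⟨ +-congˡ (*-congʳ (*-congˡ (prefactor-step m))) ⟩
    P₂ * u (suc (suc m)) + k * P₂ * F₁ (suc m)
      ≈⟨ solve 4 (λ D U k F → D :* U :+ k :* D :* F := D :* (U :+ k :* F)) refl P₂ (u (suc (suc m))) k (F₁ (suc m)) ⟩
    P₂ * (u (suc (suc m)) + k * F₁ (suc m))
      ≈⟨ *-congˡ (sym (F₁-recurrence (suc m))) ⟩
    P₂ * F₁ (suc (suc m)) ∎
    where
    X = pow s (suc (suc m)) + pow b (suc (suc m))
    P₁ = prefactor (suc m)
    P₂ = prefactor (suc (suc m))

  module _ (g : ℕ → Carrier) (g≈μ : ∀ m → g m ≈ μ m 0) (n' : ℕ) where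
    private
      n = suc n'
      hankel : ℕ → Mat n
      hankel t i j = g (toℕ i ℕ.+ toℕ j ℕ.+ t)
      bound : ∀ (i : Fin n) → toℕ i ℕ.< n
      bound = FinP.toℕ<n

    dd₀ : dd g 0 n ≈ prefactor n
    dd₀ = begin
      det n (hankel 0)
        ≈⟨ det-cong n (λ i j → trans (g≈μ (toℕ i ℕ.+ toℕ j ℕ.+ 0)) (trans (hankel₀ n (toℕ i) (toℕ j) (bound i) (bound j))
             (sym (sandwich-entry n (Dmat n) (λ r r' → δ r r' * Λ r') (λ r r' → *-congʳ (δF-toℕ r r')) i j)))) ⟩
      det n (Lmat n ⊙ (Dmat n ⊙ transpose (Lmat n)))
        ≈⟨ det-sandwich n (Dmat n) ⟩
      det n (Dmat n)
        ≈⟨ trans (det-D n) (prod-Λ n') ⟩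
      prefactor n ∎

    dd₁ : dd g 1 n ≈ prefactor n * (pow s n + pow b n)
    dd₁ = begin
      det n (hankel 1)
        ≈⟨ det-cong n (λ i j → trans (g≈μ (toℕ i ℕ.+ toℕ j ℕ.+ 1)) (trans (hankel₁ n (toℕ i) (toℕ j) (bound i) (bound j))
             (sym (sandwich-entry n (Tmat n ⊙ Dmat n) (λ r r' → T r r' * Λ r') TD-entry i j)))) ⟩
      det n (Lmat n ⊙ ((Tmat n ⊙ Dmat n) ⊙ transpose (Lmat n)))
        ≈⟨ det-sandwich n (Tmat n ⊙ Dmat n) ⟩
      det n (Tmat n ⊙ Dmat n)
        ≈⟨ det-mul n (Tmat n) (Dmat n) ⟩
      det n (Tmat n) * det n (Dmat n)
        ≈⟨ trans (*-cong (det-T n') (trans (det-D n) (prod-Λ n'))) (*-comm _ _) ⟩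
      prefactor n * (pow s n + pow b n) ∎
      where
      TD-entry : ∀ r r' → (Tmat n ⊙ Dmat n) r r' ≈ T (toℕ r) (toℕ r') * Λ (toℕ r')
      TD-entry r r' = trans
        (sumFin-cong {n} (λ q → trans (*-congˡ (*-comm (δF q r') (Λ (toℕ r')))) (sym (*-assoc (T (toℕ r) (toℕ q)) (Λ (toℕ r')) (δF q r')))))
        (sumFin-δʳ r' (λ q → T (toℕ r) (toℕ q) * Λ (toℕ r')))

    dd₂ : dd g 2 n ≈ prefactor n * F₁ n
    dd₂ = begin
      det n (hankel 2)
        ≈⟨ det-cong n (λ i j → trans (g≈μ (toℕ i ℕ.+ toℕ j ℕ.+ 2)) (trans (hankel₂ n (toℕ i) (toℕ j) (bound i) (bound j))
             (sym (sandwich-entry n (Kmat n) (T²-kernel n) (λ r r' → refl) i j)))) ⟩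
      det n (Lmat n ⊙ (Kmat n ⊙ transpose (Lmat n)))
        ≈⟨ det-sandwich n (Kmat n) ⟩
      det n (Kmat n)
        ≈⟨ det-K n' ⟩
      prefactor n * F₁ n ∎

theorem4p4 : ∀ {c ℓ} (R : CommutativeRing c ℓ) →
  let open CommutativeRing R
      open Series R
  in (∀ x → x + x ≈ 0# → x ≈ 0#) →
     (a b : Carrier) (g : ℕ → Carrier) → IsInvSqrtOf g (Qser a b) →
     (n : ℕ) → 0 < n →
     let s = a + b
         D = pow (1# + 1#) (n ∸ 1) * pow b (n C 2) * pow s (n C 2)
     in (dd g 0 n ≈ D)
        × (dd g 1 n ≈ D * (pow s n + pow b n))
        × (dd g 2 n ≈ D * (fromℕ 2 * pow b n * pow s n
                            + ∑ 1 n (λ j → pow (pow s j + pow b j) 2 * pow b (n ∸ j) * pow s (n ∸ j))))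
        × (dd g 2 n ≈ D * (∑ 0 (2 ℕ.* n) (λ j → pow s j * pow b (2 ℕ.* n ∸ j))
                            + fromℕ (2 ℕ.* n ℕ.+ 1) * pow b n * pow s n))
theorem4p4 R two a b g (g₀ , g²Q≈1) (ℕ.suc n') _ =
  dd₀ g g≈μ₀ n' , dd₁ g g≈μ₀ n' , dd₂ g g≈μ₀ n' , trans (dd₂ g g≈μ₀ n') (*-congˡ (F₁≈F₂ (ℕ.suc n')))
  where
  open CommutativeRing R using (trans; *-congˡ)
  open HankelDeterminants R a b using (dd₀; dd₁; dd₂)
  open ClosedForms R a b using (F₁≈F₂)
  g≈μ₀ = MotzkinPaths.g≈μ R a b two g g₀ g²Q≈1
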